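{- Let $n\ge 3$ and $r\ge 2$, and let $C_n$ be the cycle graph on $n$ vertices. If the complex $\Sigma_r(C_n)$ is Cohen–Macaulay (over a field $\mathbb K$), then $n\le r+2$.
   Context: $\Sigma_r(G)$ is the simplicial complex generated by the sets $V(G)\setminus W$ over all $r$-subsets $W\subseteq V(G)$ with $G[W]$ connected. A complex $\Delta$ is Cohen–Macaulay over $\mathbb K$ if $\widetilde H_i(\mathrm{lk}_\Delta(F);\mathbb K)=0$ for all faces $F$ and all $i<\dim\mathrm{lk}_\Delta(F)$. -}

module Defs where

open import Level using (Level; _⊔_)
open import Algebra.Bundles using (CommutativeRing)
open import Data.Nat as ℕ using (ℕ; zero; suc; _%_; _<ᵇ_)
open import Data.Bool using (Bool; true; false; if_then_else_; _∧_)
open import Data.Fin using (Fin; toℕ; zero; suc)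
open import Data.Fin.Subset using (Subset; _∈_; _∉_; _∪_; _⊆_; ∁; ⁅_⁆; ∣_∣)
open import Data.Vec using (lookup)
open import Data.Product using (Σ; ∃; _×_; _,_; proj₁)
open import Data.Sum using (_⊎_)
open import Relation.Nullary using (¬_)
open import Relation.Binary.PropositionalEquality using (_≡_)

record Field (c ℓ : Level) : Set (Level.suc (c ⊔ ℓ)) where
  field
    commutativeRing : CommutativeRing c ℓ
  open CommutativeRing commutativeRing public
  field
    1≉0     : ¬ (1# ≈ 0#)
    inverse : ∀ x → ¬ (x ≈ 0#) → Σ Carrier λ y → x * y ≈ 1#

Graph : ℕ → Set₁
Graph n = Fin n → Fin n → Set

data WalkIn {n : ℕ} (G : Graph n) (W : Subset n) : Fin n → Fin n → Set where
  here : ∀ {u} → u ∈ W → WalkIn G W u u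
  step : ∀ {u w v} → u ∈ W → G u w → WalkIn G W w v → WalkIn G W u v

InducedConnected : ∀ {n} → Graph n → Subset n → Set
InducedConnected {n} G W =
  (∃ λ u → u ∈ W) × (∀ u v → u ∈ W → v ∈ W → WalkIn G W u v)

CycSucc : (n : ℕ) → Fin n → Fin n → Set
CycSucc n i j = (suc (toℕ i) ≡ toℕ j) ⊎ ((suc (toℕ i) ≡ n) × (toℕ j ≡ 0))

Cycle : (n : ℕ) → Graph n
Cycle n i j = CycSucc n i j ⊎ CycSucc n j i

Complex : ℕ → Set₁
Complex n = Subset n → Set

-- Σ_r(G): generated by V(G) ∖ W over r-subsets W with G[W] connected
Sigma : ∀ {n} → ℕ → Graph n → Complex n
Sigma {n} r G F =
  ∃ λ (W : Subset n) → (∣ W ∣ ≡ r) × InducedConnected G W × (F ⊆ ∁ W)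

Link : ∀ {n} → Complex n → Subset n → Complex n
Link Δ F G = (∀ {v} → v ∈ G → v ∉ F) × Δ (G ∪ F)

isEven : ℕ → Bool
isEven zero = true
isEven (suc zero) = false
isEven (suc (suc m)) = isEven m

module Homology {c ℓ : Level} (K : Field c ℓ) where
  open Field K hiding (zero)

  sumFin : ∀ {m} → (Fin m → Carrier) → Carrier
  sumFin {zero}  f = 0#
  sumFin {suc m} f = f zero + sumFin (λ i → f (suc i))

  countFin : ∀ {m} → (Fin m → Bool) → ℕ
  countFin {zero}  f = 0
  countFin {suc m} f = (if f zero then 1 else 0) ℕ.+ countFin (λ i → f (suc i))

  -- k-chains (k = number of vertices of a face = dimension + 1) on Δ:
  -- coefficient functions on subsets vanishing off the faces of size k.
  -- Size 0 corresponds to the empty face (augmentation, dimension -1).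
  Chain : ∀ {n} → Complex n → ℕ → Set (c ⊔ ℓ)
  Chain {n} Δ k = Σ (Subset n → Carrier) λ f →
    ∀ G → ¬ ((∣ G ∣ ≡ k) × Δ G) → f G ≈ 0#

  -- sign of vertex v in the oriented simplex G ∪ {v} (vertices ordered by index)
  sign : ∀ {n} → Subset n → Fin n → Carrier
  sign {n} G v =
    if isEven (countFin (λ u → lookup G u ∧ (toℕ u <ᵇ toℕ v))) then 1# else - 1#

  ∂ : ∀ {n} → (Subset n → Carrier) → Subset n → Carrier
  ∂ f G = sumFin λ v → if lookup G v then 0# else sign G v * f (G ∪ ⁅ v ⁆)

  -- H̃_{k-1}(Δ; K) = 0 : every k-cycle is a boundary
  ReducedHomologyVanishes : ∀ {n} → Complex n → ℕ → Set (c ⊔ ℓ)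
  ReducedHomologyVanishes Δ k =
    (z : Chain Δ k) → (∀ G → ∂ (proj₁ z) G ≈ 0#) →
    Σ (Chain Δ (suc k)) λ b → ∀ G → ∂ (proj₁ b) G ≈ proj₁ z G

  -- Cohen–Macaulay over K: H̃_i(lk F) = 0 for all faces F and all i < dim lk F.
  -- With i = k - 1, "i < dim lk F" means lk F has a face with k + 1 vertices.
  CohenMacaulay : ∀ {n} → Complex n → Set (c ⊔ ℓ)
  CohenMacaulay {n} Δ =
    ∀ F → Δ F → ∀ k → (∃ λ (G : Subset n) → Link Δ F G × (∣ G ∣ ≡ suc k)) →
    ReducedHomologyVanishes (Link Δ F) k

{-# OPTIONS --safe #-}
-- The faces of Σ_r(C_n) are the vertex sets that miss some arc of r consecutive vertices, and
-- for n ≥ r + 3 a nonvanishing reduced homology group below the top dimension is exhibited by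
-- pairing a cycle z with a cocycle that vanishes on all boundaries but takes the value 1 on z.
--
-- If n ≥ 2r + 2, let F be the complement of the arcs C = {1, …, r} and D = {r + 2, …, 2r + 1}.
-- A connected r-set avoiding F is C or D, so the link of F is the disjoint union of the full
-- simplices on C and on D: it has dimension r - 1 ≥ 1 but is disconnected. The cycle is
-- {p} - {q} with p ∈ C, q ∈ D, and the cocycle is the indicator of C.
--
-- If r + 3 ≤ n ≤ 2r + 1, Σ_r(C_n) itself has dimension n - r - 1 ≥ 2, and the 1-cycle going
-- once around C_n is not a boundary. The cocycle is the indicator of the "long" edges {x, y},
-- y - x ≥ n - r, which can only be faces by wrapping around; the closing edge {0, n - 1} is the
-- only long edge of the cycle, and the coboundary vanishes on every triangle that is a face,
-- because a triangle with all three gaps shorter than r misses no r-arc.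
module Submission where

open import Defs
open import Level using (Level)
open import Data.Bool.Base using (Bool; true; false; not; _∧_; _∨_; if_then_else_; T)
import Data.Bool.Properties as Boolₚ
open import Data.Empty using () renaming (⊥ to Empty)
open import Data.Fin.Base using (Fin; zero; suc; toℕ; fromℕ<; fromℕ; inject₁; punchIn)
open import Data.Fin.Properties
  using (toℕ-injective; toℕ<n; toℕ-fromℕ<; toℕ-fromℕ; toℕ-inject₁; punchInᵢ≢i; _<?_)
  renaming (_≟_ to _≟ᶠ_)
open import Data.Fin.Subset using (Subset; _∈_; _∉_; _⊆_; _∪_; ∁; ∣_∣; ⁅_⁆; ⊥; inside; outside)
open import Data.Fin.Subset.Properties
  using ( _∈?_; ∉⊥; x∈⁅x⁆; x∈⁅y⁆⇒x≡y; x≢y⇒x∉⁅y⁆; ∣⁅x⁆∣≡1; x∈p∪q⁺; x∈p∪q⁻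
        ; x∉p⇒x∈∁p; x∉∁p⇒x∈p; x∈∁p⇒x∉p; x∈p⇒x∉∁p; ∣∁p∣≡n∸∣p∣; p⊆q⇒∣p∣≤∣q∣; p⊂q⇒∣p∣<∣q∣
        ; ⊆-antisym; ∪-comm; ∪-assoc; ∪-identityˡ; ∪-identityʳ)
open import Data.Nat.Base as ℕ using (ℕ)
import Data.Nat.Properties as ℕₚ
open import Data.Product.Base using (_×_; _,_; proj₁; proj₂; ∃)
open import Data.Sum.Base using (_⊎_; inj₁; inj₂; [_,_]′)
open import Data.Vec.Base using (tabulate; lookup; _∷_; here; there)
open import Data.Vec.Properties
  using (lookup∘tabulate; []=⇒lookup; lookup⇒[]=; lookup-zipWith; lookup-replicate; ≡-dec)
open import Function.Base using (_∘_)
open import Function.Bundles using (Equivalence)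
open import Relation.Binary.Definitions using (Tri; tri<; tri≈; tri>)
open import Relation.Binary.PropositionalEquality as ≡ using (_≡_; _≢_)
open import Relation.Nullary.Decidable.Core using (Dec; yes; no; does)
open import Relation.Nullary.Negation using (¬_; contradiction)

private
  variable
    n : ℕ

module Combinatorics where

  open import Data.Nat.Base using (zero; suc; _+_; _∸_; _≤_; _<_; _<ᵇ_; z≤n; s≤s)
  open ≡ using (refl; sym; trans; cong; cong₂; subst)
  open import Algebra.Properties.CommutativeSemigroup ℕₚ.+-commutativeSemigroup using (x∙yz≈y∙xz)

  _≟ˢ_ : (p q : Subset n) → Dec (p ≡ q)
  _≟ˢ_ = ≡-dec Boolₚ._≟_

  lookup-∉ : ∀ {x : Fin n} {p : Subset n} → x ∉ p → lookup p x ≡ false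
  lookup-∉ {x = x} {p} x∉p with lookup p x in eq
  ... | true  = contradiction (lookup⇒[]= x p eq) x∉p
  ... | false = refl

  lookup-⁅⁆ : ∀ (x u : Fin n) → lookup ⁅ x ⁆ u ≡ does (u ≟ᶠ x)
  lookup-⁅⁆ zero    zero    = refl
  lookup-⁅⁆ zero    (suc u) = lookup-replicate u outside
  lookup-⁅⁆ (suc x) zero    = refl
  lookup-⁅⁆ (suc x) (suc u) = lookup-⁅⁆ x u

  ≟-∧-subst : ∀ (u x : Fin n) (P : Fin n → Bool) → does (u ≟ᶠ x) ∧ P u ≡ does (u ≟ᶠ x) ∧ P x
  ≟-∧-subst u x P with u ≟ᶠ x
  ... | yes refl = refl
  ... | no  _    = refl

  <ᵇ≡true : ∀ {m k} → m < k → (m <ᵇ k) ≡ true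
  <ᵇ≡true m<k = Equivalence.to Boolₚ.T-≡ (ℕₚ.<⇒<ᵇ m<k)

  <ᵇ≡false : ∀ {m k} → k ≤ m → (m <ᵇ k) ≡ false
  <ᵇ≡false {m} {k} k≤m with m <ᵇ k in eq
  ... | true  = contradiction (ℕₚ.<ᵇ⇒< m k (Equivalence.from Boolₚ.T-≡ eq)) (ℕₚ.≤⇒≯ k≤m)
  ... | false = refl

  x≢y⇒⁅x⁆≢⁅y⁆ : ∀ {x y : Fin n} → x ≢ y → ⁅ x ⁆ ≢ ⁅ y ⁆
  x≢y⇒⁅x⁆≢⁅y⁆ {x = x} {y} x≢y eq = x≢y (x∈⁅y⁆⇒x≡y y (subst (x ∈_) eq (x∈⁅x⁆ x)))

  ∈⁅⁆∪⁅⁆ : ∀ (u v : Fin n) {w} → w ∈ ⁅ u ⁆ ∪ ⁅ v ⁆ → w ≡ u ⊎ w ≡ v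
  ∈⁅⁆∪⁅⁆ u v w∈uv with x∈p∪q⁻ ⁅ u ⁆ ⁅ v ⁆ w∈uv
  ... | inj₁ w∈u = inj₁ (x∈⁅y⁆⇒x≡y u w∈u)
  ... | inj₂ w∈v = inj₂ (x∈⁅y⁆⇒x≡y v w∈v)

  ⁅⁆∪⁅⁆-injective : ∀ {x y a b : Fin n} → toℕ x < toℕ y → toℕ a < toℕ b →
    ⁅ x ⁆ ∪ ⁅ y ⁆ ≡ ⁅ a ⁆ ∪ ⁅ b ⁆ → x ≡ a × y ≡ b
  ⁅⁆∪⁅⁆-injective {x = x} {y} {a} {b} x<y a<b eq
    with ∈⁅⁆∪⁅⁆ a b (subst (x ∈_) eq (x∈p∪q⁺ (inj₁ (x∈⁅x⁆ x))))
       | ∈⁅⁆∪⁅⁆ a b (subst (y ∈_) eq (x∈p∪q⁺ {p = ⁅ x ⁆} (inj₂ (x∈⁅x⁆ y))))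
       | ∈⁅⁆∪⁅⁆ x y (subst (a ∈_) (sym eq) (x∈p∪q⁺ (inj₁ (x∈⁅x⁆ a))))
  ... | inj₁ x≡a  | inj₂ y≡b  | _         = x≡a , y≡b
  ... | inj₁ refl | inj₁ refl | _         = contradiction x<y (ℕₚ.<-irrefl refl)
  ... | inj₂ refl | _         | inj₁ refl = contradiction a<b (ℕₚ.<-irrefl refl)
  ... | inj₂ refl | _         | inj₂ refl = contradiction (ℕₚ.<-trans x<y a<b) (ℕₚ.<-irrefl refl)

  ∪-⁅⁆-cancel : ∀ {v : Fin n} {p q : Subset n} → v ∉ p → v ∉ q → p ∪ ⁅ v ⁆ ≡ q ∪ ⁅ v ⁆ → p ≡ q
  ∪-⁅⁆-cancel {v = v} v∉p v∉q eq = ⊆-antisym (⊆-cancel v∉p eq) (⊆-cancel v∉q (sym eq))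
    where
    ⊆-cancel : ∀ {p q} → v ∉ p → p ∪ ⁅ v ⁆ ≡ q ∪ ⁅ v ⁆ → p ⊆ q
    ⊆-cancel {p} {q} v∉p eq {x} x∈p with x∈p∪q⁻ q ⁅ v ⁆ (subst (x ∈_) eq (x∈p∪q⁺ (inj₁ x∈p)))
    ... | inj₁ x∈q = x∈q
    ... | inj₂ x∈v = contradiction (subst (_∈ p) (x∈⁅y⁆⇒x≡y v x∈v) x∈p) v∉p

  ∣p∪⁅x⁆∣ : ∀ {p : Subset n} {x} → x ∉ p → ∣ p ∪ ⁅ x ⁆ ∣ ≡ suc ∣ p ∣
  ∣p∪⁅x⁆∣ {p = inside  ∷ p} {zero}  x∉p = contradiction here x∉p
  ∣p∪⁅x⁆∣ {p = outside ∷ p} {zero}  x∉p = cong (suc ∘ ∣_∣) (∪-identityʳ p)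
  ∣p∪⁅x⁆∣ {p = inside  ∷ p} {suc x} x∉p = cong suc (∣p∪⁅x⁆∣ (x∉p ∘ there))
  ∣p∪⁅x⁆∣ {p = outside ∷ p} {suc x} x∉p = ∣p∪⁅x⁆∣ (x∉p ∘ there)

  ∣⁅x⁆∪⁅y⁆∣ : ∀ {x y : Fin n} → x ≢ y → ∣ ⁅ x ⁆ ∪ ⁅ y ⁆ ∣ ≡ 2
  ∣⁅x⁆∪⁅y⁆∣ {x = x} x≢y = trans (∣p∪⁅x⁆∣ (x≢y ∘ sym ∘ x∈⁅y⁆⇒x≡y x)) (cong suc (∣⁅x⁆∣≡1 x))

  ⊂⇒∣∣≢ : ∀ {p q : Subset n} {x} → p ⊆ q → x ∈ q → x ∉ p → ∣ p ∣ ≢ ∣ q ∣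
  ⊂⇒∣∣≢ p⊆q x∈q x∉p ∣p∣≡∣q∣ = ℕₚ.<-irrefl ∣p∣≡∣q∣ (p⊂q⇒∣p∣<∣q∣ (p⊆q , _ , x∈q , x∉p))

  triangle : Fin n → Fin n → Fin n → Subset n
  triangle a b c = (⁅ a ⁆ ∪ ⁅ b ⁆) ∪ ⁅ c ⁆

  triangle-rotate : ∀ {n} (a b c : Fin n) → triangle b c a ≡ triangle a b c
  triangle-rotate a b c = trans (∪-comm (⁅ b ⁆ ∪ ⁅ c ⁆) ⁅ a ⁆) (sym (∪-assoc ⁅ a ⁆ ⁅ b ⁆ ⁅ c ⁆))

  triangle-swap : ∀ {n} (a b c : Fin n) → triangle a c b ≡ triangle a b c
  triangle-swap a b c = trans (∪-assoc ⁅ a ⁆ ⁅ c ⁆ ⁅ b ⁆)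
    (trans (cong (⁅ a ⁆ ∪_) (∪-comm ⁅ c ⁆ ⁅ b ⁆)) (sym (∪-assoc ⁅ a ⁆ ⁅ b ⁆ ⁅ c ⁆)))

  Link-⊥⁺ : ∀ {Δ : Complex n} {G} → Δ G → Link Δ ⊥ G
  Link-⊥⁺ {Δ = Δ} {G} ΔG = (λ _ → ∉⊥) , subst Δ (sym (∪-identityʳ G)) ΔG

  Link-⊥⁻ : ∀ {Δ : Complex n} {G} → Link Δ ⊥ G → Δ G
  Link-⊥⁻ {Δ = Δ} {G} (_ , ΔG) = subst Δ (∪-identityʳ G) ΔG

  -- Walks and connected sets

  module _ {G : Graph n} {W : Subset n} where

    WalkIn-head : ∀ {u v} → WalkIn G W u v → u ∈ W
    WalkIn-head (here u∈W)     = u∈W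
    WalkIn-head (step u∈W _ _) = u∈W

    WalkIn-snoc : ∀ {u v w} → WalkIn G W u v → G v w → w ∈ W → WalkIn G W u w
    WalkIn-snoc (here v∈W)      e w∈W = step v∈W e (here w∈W)
    WalkIn-snoc (step u∈W e′ p) e w∈W = step u∈W e′ (WalkIn-snoc p e w∈W)

    WalkIn-++ : ∀ {u v w} → WalkIn G W u v → WalkIn G W v w → WalkIn G W u w
    WalkIn-++ (here _)       q = q
    WalkIn-++ (step u∈W e p) q = step u∈W e (WalkIn-++ p q)

    WalkIn-reverse : (∀ {u v} → G u v → G v u) → ∀ {u v} → WalkIn G W u v → WalkIn G W v u
    WalkIn-reverse sym-G (here u∈W)     = here u∈W
    WalkIn-reverse sym-G (step u∈W e p) = WalkIn-snoc (WalkIn-reverse sym-G p) (sym-G e) u∈W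

    InducedConnected-hub : (∀ {u v} → G u v → G v u) → ∀ h → h ∈ W →
      (∀ {u} → u ∈ W → WalkIn G W u h) → InducedConnected G W
    InducedConnected-hub sym-G h h∈W to-h =
      (h , h∈W) , λ u v u∈W v∈W → WalkIn-++ (to-h u∈W) (WalkIn-reverse sym-G (to-h v∈W))

    InducedConnected⇒⊆ : ∀ {S : Subset n} → InducedConnected G W →
      (∀ {u v} → u ∈ S → v ∈ W → G u v → v ∈ S) → ∀ {w} → w ∈ W → w ∈ S → W ⊆ S
    InducedConnected⇒⊆ {S} (_ , walk) closed {w} w∈W w∈S {u} u∈W = along (walk w u w∈W u∈W) w∈S
      where
      along : ∀ {x y} → WalkIn G W x y → x ∈ S → y ∈ S
      along (here _)     x∈S = x∈S
      along (step _ e p) x∈S = along p (closed x∈S (WalkIn-head p) e)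

  -- Intervals and arcs of the cycle

  -- Opaque, so that lo and hi are recovered from a proof of x ∈ interval lo hi.
  opaque
    interval : ℕ → ℕ → Subset n
    interval lo hi = tabulate λ i → not (toℕ i <ᵇ lo) ∧ (toℕ i <ᵇ hi)

  opaque
    unfolding interval

    interval⁺ : ∀ {lo hi} {x : Fin n} → lo ≤ toℕ x → toℕ x < hi → x ∈ interval lo hi
    interval⁺ {lo = lo} {hi} {x} lo≤x x<hi = lookup⇒[]= x _ (trans (lookup∘tabulate _ x) bits)
      where
      bits : not (toℕ x <ᵇ lo) ∧ (toℕ x <ᵇ hi) ≡ true
      bits rewrite <ᵇ≡false lo≤x | <ᵇ≡true x<hi = refl

    interval⁻ : ∀ {lo hi} {x : Fin n} → x ∈ interval lo hi → lo ≤ toℕ x × toℕ x < hi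
    interval⁻ {lo = lo} {hi} {x} x∈I = bounds (trans (sym (lookup∘tabulate _ x)) ([]=⇒lookup x∈I))
      where
      bounds : not (toℕ x <ᵇ lo) ∧ (toℕ x <ᵇ hi) ≡ true → lo ≤ toℕ x × toℕ x < hi
      bounds bits with toℕ x <ᵇ lo in below | toℕ x <ᵇ hi in above
      bounds refl | false | true =
        ℕₚ.≮⇒≥ (λ x<lo → subst T below (ℕₚ.<⇒<ᵇ x<lo)) , ℕₚ.<ᵇ⇒< _ _ (subst T (sym above) _)

    ∣interval∣ : ∀ {n} lo hi → hi ≤ n → ∣ interval {n} lo hi ∣ ≡ hi ∸ lo
    ∣interval∣ {zero}  lo       zero     _          = sym (ℕₚ.0∸n≡0 lo)
    ∣interval∣ {suc n} zero     zero     _          = ∣interval∣ {n} 0 0 z≤n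
    ∣interval∣ {suc n} zero     (suc hi) (s≤s hi≤n) = cong suc (∣interval∣ {n} 0 hi hi≤n)
    ∣interval∣ {suc n} (suc lo) zero     _          = trans (∣interval∣ {n} lo 0 z≤n) (ℕₚ.0∸n≡0 lo)
    ∣interval∣ {suc n} (suc lo) (suc hi) (s≤s hi≤n) = ∣interval∣ {n} lo hi hi≤n

  Cycle-sym : ∀ {u v : Fin n} → Cycle n u v → Cycle n v u
  Cycle-sym (inj₁ uv) = inj₂ uv
  Cycle-sym (inj₂ vu) = inj₁ vu

  Cycle-interior : ∀ {a v b u : Fin n} → toℕ a < toℕ v → toℕ v < toℕ b → Cycle n v u →
    toℕ a ≤ toℕ u × toℕ u ≤ toℕ b
  Cycle-interior a<v v<b (inj₁ (inj₁ v+1≡u)) =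
    ℕₚ.<⇒≤ (ℕₚ.<-≤-trans a<v (ℕₚ.≤-trans (ℕₚ.n≤1+n _) (ℕₚ.≤-reflexive v+1≡u))) , subst (_≤ _) v+1≡u v<b
  Cycle-interior {b = b} a<v v<b (inj₁ (inj₂ (v+1≡n , _))) =
    contradiction (subst (_≤ toℕ b) v+1≡n v<b) (ℕₚ.<⇒≱ (toℕ<n b))
  Cycle-interior a<v v<b (inj₂ (inj₁ u+1≡v)) =
    ℕₚ.≤-pred (subst (_ <_) (sym u+1≡v) a<v) , ℕₚ.<⇒≤ (ℕₚ.<-trans (subst (_ <_) u+1≡v ℕₚ.≤-refl) v<b)
  Cycle-interior a<v v<b (inj₂ (inj₂ (_ , v≡0))) = contradiction (subst (_ <_) v≡0 a<v) ℕₚ.n≮0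

  descending-walk : ∀ {W : Subset n} {h u : Fin n} → toℕ h ≤ toℕ u →
    (∀ {x : Fin n} → toℕ h ≤ toℕ x → toℕ x ≤ toℕ u → x ∈ W) → WalkIn (Cycle n) W u h
  descending-walk {n} {W} {h} {u} h≤u = go (toℕ u ∸ toℕ h) (ℕₚ.m+[n∸m]≡n h≤u)
    where
    go : ∀ d {u} → toℕ h + d ≡ toℕ u → (∀ {x : Fin n} → toℕ h ≤ toℕ x → toℕ x ≤ toℕ u → x ∈ W) →
      WalkIn (Cycle n) W u h
    go zero {u} h+0≡u run = subst (λ v → WalkIn (Cycle n) W v h) (toℕ-injective h≡u)
      (here (run ℕₚ.≤-refl (ℕₚ.≤-reflexive h≡u)))
      where
      h≡u : toℕ h ≡ toℕ u
      h≡u = trans (sym (ℕₚ.+-identityʳ _)) h+0≡u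
    go (suc d) {u} h+d+1≡u run =
      step (run (subst (toℕ h ≤_) h+d+1≡u (ℕₚ.m≤m+n _ _)) ℕₚ.≤-refl)
           (inj₂ (inj₁ (trans (cong suc (toℕ-fromℕ< h+d<n)) h+d+1≡u′)))
           (go d (sym (toℕ-fromℕ< h+d<n)) λ h≤x x≤u′ → run h≤x (ℕₚ.≤-trans x≤u′ u′≤u))
      where
      h+d+1≡u′ : suc (toℕ h + d) ≡ toℕ u
      h+d+1≡u′ = trans (sym (ℕₚ.+-suc (toℕ h) d)) h+d+1≡u
      h+d<n : toℕ h + d < n
      h+d<n = ℕₚ.<-≤-trans (ℕₚ.≤-reflexive h+d+1≡u′) (ℕₚ.<⇒≤ (toℕ<n u))
      u′≤u : toℕ (fromℕ< h+d<n) ≤ toℕ u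
      u′≤u = subst (_≤ toℕ u) (sym (toℕ-fromℕ< h+d<n)) (ℕₚ.<⇒≤ (ℕₚ.≤-reflexive h+d+1≡u′))

  interval-connected : ∀ {lo hi} → lo < hi → hi ≤ n → InducedConnected (Cycle n) (interval lo hi)
  interval-connected {n} {lo} {hi} lo<hi hi≤n =
    InducedConnected-hub Cycle-sym start
      (interval⁺ (ℕₚ.≤-reflexive (sym start≡lo)) (subst (_< hi) (sym start≡lo) lo<hi))
      λ u∈I → let lo≤u , u<hi = interval⁻ u∈I in
        descending-walk (subst (_≤ _) (sym start≡lo) lo≤u)
          λ start≤x x≤u → interval⁺ (subst (_≤ _) start≡lo start≤x) (ℕₚ.≤-<-trans x≤u u<hi)
    where
    start : Fin n
    start = fromℕ< (ℕₚ.<-≤-trans lo<hi hi≤n)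
    start≡lo : toℕ start ≡ lo
    start≡lo = toℕ-fromℕ< _

  ∁interval-connected : ∀ {N lo hi} → 0 < lo → hi ≤ suc N →
    InducedConnected (Cycle (suc N)) (∁ (interval lo hi))
  ∁interval-connected {N} {lo} {hi} 0<lo hi≤n =
    InducedConnected-hub Cycle-sym zero (outside-below z≤n 0<lo) to-zero
    where
    outside-below : ∀ {x : Fin (suc N)} {k} → toℕ x ≤ k → k < lo → x ∈ ∁ (interval lo hi)
    outside-below x≤k k<lo = x∉p⇒x∈∁p λ x∈I → ℕₚ.<⇒≱ (ℕₚ.≤-<-trans x≤k k<lo) (proj₁ (interval⁻ x∈I))
    outside-above : ∀ {x : Fin (suc N)} {k} → hi ≤ k → k ≤ toℕ x → x ∈ ∁ (interval lo hi)
    outside-above hi≤k k≤x = x∉p⇒x∈∁p λ x∈I → ℕₚ.<⇒≱ (proj₂ (interval⁻ x∈I)) (ℕₚ.≤-trans hi≤k k≤x)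
    to-zero : ∀ {u} → u ∈ ∁ (interval lo hi) → WalkIn (Cycle (suc N)) (∁ (interval lo hi)) u zero
    to-zero {u} u∈O with toℕ u ℕₚ.<? lo
    ... | yes u<lo = descending-walk z≤n λ _ x≤u → outside-below x≤u u<lo
    ... | no  u≮lo = WalkIn-snoc
        (WalkIn-reverse Cycle-sym (descending-walk (subst (toℕ u ≤_) (sym (toℕ-fromℕ N)) (ℕₚ.≤-pred (toℕ<n u)))
          λ u≤x _ → outside-above hi≤u u≤x))
        (inj₁ (inj₂ (cong suc (toℕ-fromℕ N) , refl)))
        (outside-below z≤n 0<lo)
      where
      hi≤u : hi ≤ toℕ u
      hi≤u = ℕₚ.≮⇒≥ λ u<hi → x∈∁p⇒x∉p u∈O (interval⁺ (ℕₚ.≮⇒≥ u≮lo) u<hi)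

  innerArc outerArc : Fin n → Fin n → Subset n
  innerArc a b = interval (suc (toℕ a)) (toℕ b)
  outerArc a b = ∁ (interval (toℕ a) (suc (toℕ b)))

  module _ {W : Subset n} {a b : Fin n}
    (W-conn : InducedConnected (Cycle n) W) (a∉W : a ∉ W) (b∉W : b ∉ W) where

    private
      avoids : ∀ {c v} → c ∉ W → v ∈ W → toℕ c ≢ toℕ v
      avoids c∉W v∈W c≡v = c∉W (subst (_∈ W) (toℕ-injective (sym c≡v)) v∈W)

      strictly-between : ∀ {v} → v ∈ W → toℕ a ≤ toℕ v → toℕ v ≤ toℕ b → toℕ a < toℕ v × toℕ v < toℕ b
      strictly-between v∈W a≤v v≤b =
        ℕₚ.≤∧≢⇒< a≤v (avoids a∉W v∈W) , ℕₚ.≤∧≢⇒< v≤b (λ v≡b → avoids b∉W v∈W (sym v≡b))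

    innerArc-trap : ∀ {w} → w ∈ W → w ∈ innerArc a b → W ⊆ innerArc a b
    innerArc-trap = InducedConnected⇒⊆ W-conn closed
      where
      closed : ∀ {u v} → u ∈ innerArc a b → v ∈ W → Cycle n u v → v ∈ innerArc a b
      closed u∈I v∈W u~v =
        let a<u , u<b = interval⁻ u∈I
            a≤v , v≤b = Cycle-interior a<u u<b u~v
            a<v , v<b = strictly-between v∈W a≤v v≤b
        in interval⁺ a<v v<b

    outerArc-trap : ∀ {w} → w ∈ W → w ∈ outerArc a b → W ⊆ outerArc a b
    outerArc-trap = InducedConnected⇒⊆ W-conn closed
      where
      closed : ∀ {u v} → u ∈ outerArc a b → v ∈ W → Cycle n u v → v ∈ outerArc a b
      closed u∈O v∈W u~v = x∉p⇒x∈∁p λ v∈I →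
        let a≤v , v≤b = interval⁻ v∈I
            a<v , v<b = strictly-between v∈W a≤v (ℕₚ.≤-pred v≤b)
            a≤u , u≤b = Cycle-interior a<v v<b (Cycle-sym u~v)
        in x∈∁p⇒x∉p u∈O (interval⁺ a≤u (s≤s u≤b))

  innerArc-bound : ∀ {W : Subset n} {a b : Fin n} → toℕ a < toℕ b → W ⊆ innerArc a b →
    ∣ W ∣ + suc (toℕ a) ≤ toℕ b
  innerArc-bound {a = a} {b} a<b W⊆I = ℕₚ.m≤o∸n⇒m+n≤o _ a<b
    (subst (_ ≤_) (∣interval∣ (suc (toℕ a)) (toℕ b) (ℕₚ.<⇒≤ (toℕ<n b))) (p⊆q⇒∣p∣≤∣q∣ W⊆I))

  outerArc-bound : ∀ {W : Subset n} {a b : Fin n} → W ⊆ outerArc a b → ∣ W ∣ + suc (toℕ b) ≤ n + toℕ a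
  outerArc-bound {n} {W} {a} {b} W⊆O = begin
    ∣ W ∣ + suc (toℕ b)                      ≤⟨ ℕₚ.+-monoʳ-≤ ∣ W ∣ (ℕₚ.m≤n+m∸n (suc (toℕ b)) (toℕ a)) ⟩
    ∣ W ∣ + (toℕ a + (suc (toℕ b) ∸ toℕ a))  ≡⟨ x∙yz≈y∙xz ∣ W ∣ (toℕ a) _ ⟩
    toℕ a + (∣ W ∣ + (suc (toℕ b) ∸ toℕ a))  ≤⟨ ℕₚ.+-monoʳ-≤ (toℕ a) W+span≤n ⟩
    toℕ a + n                                ≡⟨ ℕₚ.+-comm (toℕ a) n ⟩
    n + toℕ a                                ∎
    where
    open ℕₚ.≤-Reasoning
    ∣outerArc∣ : ∣ outerArc a b ∣ ≡ n ∸ (suc (toℕ b) ∸ toℕ a)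
    ∣outerArc∣ = trans (∣∁p∣≡n∸∣p∣ (interval (toℕ a) (suc (toℕ b))))
                       (cong (n ∸_) (∣interval∣ (toℕ a) (suc (toℕ b)) (toℕ<n b)))
    W+span≤n : ∣ W ∣ + (suc (toℕ b) ∸ toℕ a) ≤ n
    W+span≤n = ℕₚ.m≤o∸n⇒m+n≤o _ (ℕₚ.≤-trans (ℕₚ.m∸n≤m (suc (toℕ b)) (toℕ a)) (toℕ<n b))
      (subst (_ ≤_) ∣outerArc∣ (p⊆q⇒∣p∣≤∣q∣ W⊆O))

  -- Faces of Σ_r(C_n)

  module _ {r : ℕ} where

    interval-face : ∀ {lo} {S : Subset n} → 0 < r → lo + r ≤ n →
      (∀ {x} → x ∈ S → x ∉ interval lo (lo + r)) → Sigma r (Cycle n) S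
    interval-face {lo = lo} 0<r lo+r≤n avoid =
      interval lo (lo + r) ,
      trans (∣interval∣ lo (lo + r) lo+r≤n) (ℕₚ.m+n∸m≡n lo r) ,
      interval-connected (ℕₚ.m<m+n lo 0<r) lo+r≤n ,
      λ x∈S → x∉p⇒x∈∁p (avoid x∈S)

    ∁interval-face : ∀ {N lo m} {S : Subset (suc N)} → 0 < lo → lo + m ≤ suc N → m + r ≡ suc N →
      S ⊆ interval lo (lo + m) → Sigma r (Cycle (suc N)) S
    ∁interval-face {N} {lo} {m} 0<lo lo+m≤n m+r≡n S⊆I =
      ∁ (interval lo (lo + m)) , card , ∁interval-connected 0<lo lo+m≤n , λ x∈S → x∉p⇒x∈∁p (x∈p⇒x∉∁p (S⊆I x∈S))
      where
      card : ∣ ∁ (interval lo (lo + m)) ∣ ≡ r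
      card = begin
        ∣ ∁ (interval lo (lo + m)) ∣      ≡⟨ ∣∁p∣≡n∸∣p∣ (interval lo (lo + m)) ⟩
        suc N ∸ ∣ interval lo (lo + m) ∣  ≡⟨ cong (suc N ∸_) (∣interval∣ lo (lo + m) lo+m≤n) ⟩
        suc N ∸ (lo + m ∸ lo)             ≡⟨ cong (suc N ∸_) (ℕₚ.m+n∸m≡n lo m) ⟩
        suc N ∸ m                         ≡⟨ cong (_∸ m) (sym m+r≡n) ⟩
        m + r ∸ m                         ≡⟨ ℕₚ.m+n∸m≡n m r ⟩
        r                                 ∎
        where open ≡.≡-Reasoning

    -- The missed r-arc starts at hi, wrapping around past n - 1 if necessary.
    arc-face : ∀ {N lo hi} {S : Subset (suc N)} → 0 < r → hi ≤ suc N → (hi ∸ lo) + r ≤ suc N →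
      S ⊆ interval lo hi → Sigma r (Cycle (suc N)) S
    arc-face {N} {lo} {hi} 0<r hi≤n short S⊆I with hi + r ℕₚ.≤? suc N
    ... | yes hi+r≤n = interval-face 0<r hi+r≤n λ x∈S x∈J →
            ℕₚ.<⇒≱ (proj₂ (interval⁻ (S⊆I x∈S))) (proj₁ (interval⁻ x∈J))
    ... | no  hi+r≰n = ∁interval-face 0<start (subst (_≤ suc N) (sym start+m≡hi) hi≤n) m+r≡n
            λ x∈S → let lo≤x , x<hi = interval⁻ (S⊆I x∈S) in
              interval⁺ (ℕₚ.≤-trans start≤lo lo≤x) (subst (_ <_) (sym start+m≡hi) x<hi)
      where
      m = suc N ∸ r
      r≤n : r ≤ suc N
      r≤n = ℕₚ.≤-trans (ℕₚ.m≤n+m r (hi ∸ lo)) short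
      m+r≡n : m + r ≡ suc N
      m+r≡n = ℕₚ.m∸n+n≡m r≤n
      m<hi : m < hi
      m<hi = subst (m <_) (ℕₚ.m+n∸n≡m hi r) (ℕₚ.∸-monoˡ-< (ℕₚ.≰⇒> hi+r≰n) r≤n)
      start = hi ∸ m
      0<start : 0 < start
      0<start = ℕₚ.m<n⇒0<n∸m m<hi
      start+m≡hi : start + m ≡ hi
      start+m≡hi = ℕₚ.m∸n+n≡m (ℕₚ.<⇒≤ m<hi)
      start≤lo : start ≤ lo
      start≤lo = ℕₚ.m≤n+o⇒m∸n≤o hi m (subst (hi ≤_) (ℕₚ.+-comm lo m)
        (ℕₚ.≤-trans (ℕₚ.m≤n+m∸n hi lo) (ℕₚ.+-monoʳ-≤ lo (ℕₚ.m+n≤o⇒m≤o∸n (hi ∸ lo) short))))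

  private
    gap-contradiction : ∀ {r x y} → r + suc x ≤ y → y ≤ x + r → Empty
    gap-contradiction {r} {x} r+x<y y≤x+r =
      ℕₚ.<-irrefl (ℕₚ.+-comm r x) (subst (_≤ x + r) (ℕₚ.+-suc r x) (ℕₚ.≤-trans r+x<y y≤x+r))

  module _ {r : ℕ} {W : Subset n} (∣W∣≡r : ∣ W ∣ ≡ r) where

    short-innerArc : ∀ {a b : Fin n} → toℕ a < toℕ b → toℕ b ≤ toℕ a + r → ¬ W ⊆ innerArc a b
    short-innerArc a<b b≤a+r W⊆I =
      gap-contradiction (subst (λ k → k + _ ≤ _) ∣W∣≡r (innerArc-bound a<b W⊆I)) b≤a+r

    short-outerArc : ∀ {a b : Fin n} → n + toℕ a ≤ toℕ b + r → ¬ W ⊆ outerArc a b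
    short-outerArc n+a≤b+r W⊆O = gap-contradiction (subst (λ k → k + _ ≤ _) ∣W∣≡r (outerArc-bound W⊆O)) n+a≤b+r

  triangle-nonface : ∀ {r} {a b c : Fin n} → toℕ a < toℕ b → toℕ b < toℕ c →
    toℕ b ≤ toℕ a + r → toℕ c ≤ toℕ b + r → n + toℕ a ≤ toℕ c + r → ¬ Sigma r (Cycle n) (triangle a b c)
  triangle-nonface {n} {a = a} {b} {c} a<b b<c ab-short bc-short ca-short (W , ∣W∣≡r , W-conn , T⊆∁W) =
    locate (proj₁ W-conn)
    where
    a∉W = x∈∁p⇒x∉p (T⊆∁W (x∈p∪q⁺ (inj₁ (x∈p∪q⁺ (inj₁ (x∈⁅x⁆ a))))))
    b∉W = x∈∁p⇒x∉p (T⊆∁W (x∈p∪q⁺ (inj₁ (x∈p∪q⁺ {p = ⁅ a ⁆} (inj₂ (x∈⁅x⁆ b))))))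
    c∉W = x∈∁p⇒x∉p (T⊆∁W (x∈p∪q⁺ {p = ⁅ a ⁆ ∪ ⁅ b ⁆} (inj₂ (x∈⁅x⁆ c))))
    locate : ∃ (_∈ W) → Empty
    locate (w , w∈W) with ℕₚ.<-cmp (toℕ w) (toℕ a) | ℕₚ.<-cmp (toℕ w) (toℕ b) | ℕₚ.<-cmp (toℕ w) (toℕ c)
    ... | tri< w<a _ _ | _ | _ = short-outerArc ∣W∣≡r ca-short
      (outerArc-trap W-conn a∉W c∉W w∈W (x∉p⇒x∈∁p λ w∈I → ℕₚ.<⇒≱ w<a (proj₁ (interval⁻ w∈I))))
    ... | tri≈ _ w≡a _ | _ | _ = a∉W (subst (_∈ W) (toℕ-injective w≡a) w∈W)
    ... | tri> _ _ a<w | tri< w<b _ _ | _ =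
      short-innerArc ∣W∣≡r a<b ab-short (innerArc-trap W-conn a∉W b∉W w∈W (interval⁺ a<w w<b))
    ... | tri> _ _ _ | tri≈ _ w≡b _ | _ = b∉W (subst (_∈ W) (toℕ-injective w≡b) w∈W)
    ... | tri> _ _ _ | tri> _ _ b<w | tri< w<c _ _ =
      short-innerArc ∣W∣≡r b<c bc-short (innerArc-trap W-conn b∉W c∉W w∈W (interval⁺ b<w w<c))
    ... | tri> _ _ _ | tri> _ _ _ | tri≈ _ w≡c _ = c∉W (subst (_∈ W) (toℕ-injective w≡c) w∈W)
    ... | tri> _ _ _ | tri> _ _ _ | tri> _ _ c<w = short-outerArc ∣W∣≡r ca-short
      (outerArc-trap W-conn a∉W c∉W w∈W (x∉p⇒x∈∁p λ w∈I → ℕₚ.<⇒≱ (proj₂ (interval⁻ w∈I)) c<w))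

  module TwoArcs {n r : ℕ} (2r+2≤n : 2 + r + r ≤ n) (2≤r : 2 ≤ r) where

    C D F : Subset n
    C = interval 1 (1 + r)
    D = interval (2 + r) (2 + r + r)
    F = ∁ (C ∪ D)

    private
      0<r : 0 < r
      0<r = ℕₚ.<-≤-trans (s≤s z≤n) 2≤r
      1+r<n : 1 + r < n
      1+r<n = ℕₚ.≤-trans (ℕₚ.m≤m+n (2 + r) r) 2r+2≤n
      1+r≤n : 1 + r ≤ n
      1+r≤n = ℕₚ.<⇒≤ 1+r<n
      vertex : ∀ k → k < n → Fin n
      vertex k k<n = fromℕ< k<n
      vertex∈ : ∀ {lo hi k} (k<n : k < n) → lo ≤ k → k < hi → vertex k k<n ∈ interval lo hi
      vertex∈ k<n lo≤k k<hi =
        interval⁺ (subst (_ ≤_) (sym (toℕ-fromℕ< k<n)) lo≤k) (subst (_< _) (sym (toℕ-fromℕ< k<n)) k<hi)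
      C∩D≡∅ : ∀ {x} → x ∈ C → x ∉ D
      C∩D≡∅ x∈C x∈D = ℕₚ.<⇒≱ (proj₂ (interval⁻ x∈C)) (ℕₚ.≤-trans (ℕₚ.n≤1+n _) (proj₁ (interval⁻ x∈D)))
      F∩C≡∅ : ∀ {x} → x ∈ F → x ∉ C
      F∩C≡∅ x∈F x∈C = x∈∁p⇒x∉p x∈F (x∈p∪q⁺ (inj₁ x∈C))
      F∩D≡∅ : ∀ {x} → x ∈ F → x ∉ D
      F∩D≡∅ x∈F x∈D = x∈∁p⇒x∉p x∈F (x∈p∪q⁺ {p = C} (inj₂ x∈D))

    ∣C∣≡r : ∣ C ∣ ≡ r
    ∣C∣≡r = ∣interval∣ 1 (1 + r) 1+r≤n

    ∣D∣≡r : ∣ D ∣ ≡ r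
    ∣D∣≡r = trans (∣interval∣ (2 + r) (2 + r + r) 2r+2≤n) (ℕₚ.m+n∸m≡n (2 + r) r)

    F-face : Sigma r (Cycle n) F
    F-face = interval-face 0<r 1+r≤n F∩C≡∅

    ⊆C⇒link : ∀ {G} → G ⊆ C → Link (Sigma r (Cycle n)) F G
    ⊆C⇒link G⊆C = (λ v∈G v∈F → F∩C≡∅ v∈F (G⊆C v∈G)) , interval-face 0<r 2r+2≤n avoid
      where
      avoid : ∀ {x} → x ∈ _ ∪ F → x ∉ D
      avoid x∈G∪F with x∈p∪q⁻ _ F x∈G∪F
      ... | inj₁ x∈G = C∩D≡∅ (G⊆C x∈G)
      ... | inj₂ x∈F = F∩D≡∅ x∈F

    ⊆D⇒link : ∀ {G} → G ⊆ D → Link (Sigma r (Cycle n)) F G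
    ⊆D⇒link G⊆D = (λ v∈G v∈F → F∩D≡∅ v∈F (G⊆D v∈G)) , interval-face 0<r 1+r≤n avoid
      where
      avoid : ∀ {x} → x ∈ _ ∪ F → x ∉ C
      avoid x∈G∪F x∈C with x∈p∪q⁻ _ F x∈G∪F
      ... | inj₁ x∈G = C∩D≡∅ x∈C (G⊆D x∈G)
      ... | inj₂ x∈F = F∩C≡∅ x∈F x∈C

    private
      sep₀ sep₁ : Fin n
      sep₀ = vertex 0 (ℕₚ.<-≤-trans (s≤s z≤n) 1+r<n)
      sep₁ = vertex (1 + r) 1+r<n

      sep₀∈F : sep₀ ∈ F
      sep₀∈F = x∉p⇒x∈∁p λ sep₀∈C∪D → ℕₚ.n≮0 (subst (0 <_) (toℕ-fromℕ< _) (positive (x∈p∪q⁻ C D sep₀∈C∪D)))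
        where
        positive : sep₀ ∈ C ⊎ sep₀ ∈ D → 0 < toℕ sep₀
        positive (inj₁ sep₀∈C) = proj₁ (interval⁻ sep₀∈C)
        positive (inj₂ sep₀∈D) = ℕₚ.<-≤-trans (s≤s z≤n) (proj₁ (interval⁻ sep₀∈D))

      sep₁∈F : sep₁ ∈ F
      sep₁∈F = x∉p⇒x∈∁p λ sep₁∈C∪D →
        ℕₚ.<-irrefl refl (subst (_< 1 + r) (toℕ-fromℕ< _) (before-D (x∈p∪q⁻ C D sep₁∈C∪D)))
        where
        before-D : sep₁ ∈ C ⊎ sep₁ ∈ D → toℕ sep₁ < 1 + r
        before-D (inj₁ sep₁∈C) = proj₂ (interval⁻ sep₁∈C)
        before-D (inj₂ sep₁∈D) =
          contradiction (subst (2 + r ≤_) (toℕ-fromℕ< _) (proj₁ (interval⁻ sep₁∈D))) (ℕₚ.<-irrefl refl)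

      innerArc≡C : innerArc sep₀ sep₁ ≡ C
      innerArc≡C = cong₂ interval (cong suc (toℕ-fromℕ< _)) (toℕ-fromℕ< _)

      outerArc≡ : outerArc sep₀ sep₁ ≡ ∁ (interval 0 (2 + r))
      outerArc≡ = cong₂ (λ lo hi → ∁ (interval lo hi)) (toℕ-fromℕ< _) (cong suc (toℕ-fromℕ< _))

    -- The vertices 0 and r + 1 of F separate C from D.
    connected-avoiding-F : ∀ {W} → InducedConnected (Cycle n) W → (∀ {x} → x ∈ F → x ∉ W) → W ⊆ C ⊎ W ⊆ D
    connected-avoiding-F {W} W-conn F∩W≡∅ = locate (proj₁ W-conn)
      where
      W⊆C∪D : W ⊆ C ∪ D
      W⊆C∪D x∈W = x∉∁p⇒x∈p λ x∈F → F∩W≡∅ x∈F x∈W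
      locate : ∃ (_∈ W) → W ⊆ C ⊎ W ⊆ D
      locate (w , w∈W) with x∈p∪q⁻ C D (W⊆C∪D w∈W)
      ... | inj₁ w∈C = inj₁ (subst (W ⊆_) innerArc≡C
              (innerArc-trap W-conn (F∩W≡∅ sep₀∈F) (F∩W≡∅ sep₁∈F) w∈W (subst (w ∈_) (sym innerArc≡C) w∈C)))
      ... | inj₂ w∈D = inj₂ W⊆D
        where
        W⊆O : W ⊆ outerArc sep₀ sep₁
        W⊆O = outerArc-trap W-conn (F∩W≡∅ sep₀∈F) (F∩W≡∅ sep₁∈F) w∈W
          (subst (w ∈_) (sym outerArc≡)
            (x∉p⇒x∈∁p λ w∈I → ℕₚ.<⇒≱ (proj₂ (interval⁻ w∈I)) (proj₁ (interval⁻ w∈D))))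
        W⊆D : W ⊆ D
        W⊆D x∈W with x∈p∪q⁻ C D (W⊆C∪D x∈W)
        ... | inj₂ x∈D = x∈D
        ... | inj₁ x∈C = contradiction (interval⁺ z≤n (ℕₚ.m≤n⇒m≤1+n (proj₂ (interval⁻ x∈C))))
                                       (x∈∁p⇒x∉p (subst (_ ∈_) outerArc≡ (W⊆O x∈W)))

    crossing∉link : ∀ {u v} → u ∈ C → v ∉ C → ¬ Link (Sigma r (Cycle n)) F (⁅ u ⁆ ∪ ⁅ v ⁆)
    crossing∉link {u} {v} u∈C v∉C (uv∩F≡∅ , W , ∣W∣≡r , W-conn , uv∪F⊆∁W) =
      refute (connected-avoiding-F W-conn (∉W ∘ x∈p∪q⁺ ∘ inj₂))
      where
      ∉W : ∀ {x} → x ∈ (⁅ u ⁆ ∪ ⁅ v ⁆) ∪ F → x ∉ W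
      ∉W x∈uv∪F = x∈∁p⇒x∉p (uv∪F⊆∁W x∈uv∪F)
      u∈uv = x∈p∪q⁺ (inj₁ (x∈⁅x⁆ u))
      v∈uv = x∈p∪q⁺ {p = ⁅ u ⁆} (inj₂ (x∈⁅x⁆ v))
      v∈D : v ∈ D
      v∈D with x∈p∪q⁻ C D (x∉∁p⇒x∈p (uv∩F≡∅ v∈uv))
      ... | inj₁ v∈C = contradiction v∈C v∉C
      ... | inj₂ v∈D = v∈D
      refute : W ⊆ C ⊎ W ⊆ D → Empty
      refute (inj₁ W⊆C) = ⊂⇒∣∣≢ W⊆C u∈C (∉W (x∈p∪q⁺ (inj₁ u∈uv))) (trans ∣W∣≡r (sym ∣C∣≡r))
      refute (inj₂ W⊆D) = ⊂⇒∣∣≢ W⊆D v∈D (∉W (x∈p∪q⁺ (inj₁ v∈uv))) (trans ∣W∣≡r (sym ∣D∣≡r))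

    private
      2<n : 2 < n
      2<n = ℕₚ.<-≤-trans (s≤s (s≤s (s≤s z≤n))) (ℕₚ.≤-trans (s≤s (s≤s 0<r)) 1+r<n)
      2+r<n : 2 + r < n
      2+r<n = ℕₚ.<-≤-trans (ℕₚ.m<m+n (2 + r) 0<r) 2r+2≤n
      1<n : 1 < n
      1<n = ℕₚ.<-trans (s≤s (s≤s z≤n)) 2<n

    p p₂ q : Fin n
    p  = vertex 1 1<n
    p₂ = vertex 2 2<n
    q  = vertex (2 + r) 2+r<n

    p∈C : p ∈ C
    p∈C = vertex∈ 1<n (s≤s z≤n) (s≤s 0<r)

    p₂∈C : p₂ ∈ C
    p₂∈C = vertex∈ 2<n (s≤s z≤n) (s≤s 2≤r)

    q∈D : q ∈ D
    q∈D = vertex∈ 2+r<n ℕₚ.≤-refl (ℕₚ.m<m+n (2 + r) 0<r)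

    q∉C : q ∉ C
    q∉C q∈C = C∩D≡∅ q∈C q∈D

    p≢p₂ : p ≢ p₂
    p≢p₂ p≡p₂ = ℕₚ.<-irrefl (trans (sym (toℕ-fromℕ< 1<n)) (trans (cong toℕ p≡p₂) (toℕ-fromℕ< 2<n))) (ℕₚ.n<1+n 1)

  module LongEdges {N r : ℕ} (r+3≤n : r + 3 ≤ suc N) (n≤2r+1 : suc N ≤ r + suc r) (0<r : 0 < r) where

    m : ℕ
    m = suc N ∸ r

    private
      r≤n : r ≤ suc N
      r≤n = ℕₚ.≤-trans (ℕₚ.m≤m+n r 3) r+3≤n
      m+r≡n : m + r ≡ suc N
      m+r≡n = ℕₚ.m∸n+n≡m r≤n
      3≤m : 3 ≤ m
      3≤m = ℕₚ.m+n≤o⇒m≤o∸n 3 (subst (_≤ suc N) (ℕₚ.+-comm r 3) r+3≤n)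
      m≤1+r : m ≤ suc r
      m≤1+r = ℕₚ.m≤n+o⇒m∸n≤o (suc N) r n≤2r+1
      3≤n : 3 ≤ suc N
      3≤n = ℕₚ.≤-trans (ℕₚ.m≤n+m 3 r) r+3≤n
      1<n : 1 < suc N
      1<n = ℕₚ.≤-trans (s≤s (s≤s z≤n)) 3≤n

    Long : Fin (suc N) → Fin (suc N) → Set
    Long x y = toℕ x + m ≤ toℕ y

    Long? : ∀ x y → Dec (Long x y)
    Long? x y = toℕ x + m ℕₚ.≤? toℕ y

    Long⇒< : ∀ {x y} → Long x y → toℕ x < toℕ y
    Long⇒< {x} x+m≤y = ℕₚ.<-≤-trans (ℕₚ.m<m+n (toℕ x) (ℕₚ.<-≤-trans (s≤s z≤n) 3≤m)) x+m≤y

    Long-extendʳ : ∀ {a b c} → Long a b → toℕ b ≤ toℕ c → Long a c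
    Long-extendʳ = ℕₚ.≤-trans

    Long-extendˡ : ∀ {a b c} → toℕ a ≤ toℕ b → Long b c → Long a c
    Long-extendˡ a≤b = ℕₚ.≤-trans (ℕₚ.+-monoˡ-≤ m a≤b)

    ¬Long-successor : ∀ {x y} → toℕ y ≡ suc (toℕ x) → ¬ Long x y
    ¬Long-successor {x} y≡x+1 x+m≤y = ℕₚ.<⇒≱ (ℕₚ.<-≤-trans (s≤s (s≤s z≤n)) 3≤m)
      (ℕₚ.+-cancelˡ-≤ (toℕ x) m 1 (subst (toℕ x + m ≤_) (trans y≡x+1 (sym (ℕₚ.+-comm (toℕ x) 1))) x+m≤y))

    private
      Long⇒wrap-short : ∀ {a c} → Long a c → suc N + toℕ a ≤ toℕ c + r
      Long⇒wrap-short {a} {c} a+m≤c = begin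
        suc N + toℕ a    ≡⟨ cong (_+ toℕ a) (sym m+r≡n) ⟩
        m + r + toℕ a    ≡⟨ ℕₚ.+-comm (m + r) (toℕ a) ⟩
        toℕ a + (m + r)  ≡⟨ sym (ℕₚ.+-assoc (toℕ a) m r) ⟩
        toℕ a + m + r    ≤⟨ ℕₚ.+-monoˡ-≤ r a+m≤c ⟩
        toℕ c + r        ∎
        where open ℕₚ.≤-Reasoning
      ¬Long⇒short : ∀ {a b} → ¬ Long a b → toℕ b ≤ toℕ a + r
      ¬Long⇒short {a} {b} ¬a+m≤b = ℕₚ.≤-pred (begin-strict
        toℕ b            <⟨ ℕₚ.≰⇒> ¬a+m≤b ⟩
        toℕ a + m        ≤⟨ ℕₚ.+-monoʳ-≤ (toℕ a) m≤1+r ⟩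
        toℕ a + suc r    ≡⟨ ℕₚ.+-suc (toℕ a) r ⟩
        suc (toℕ a + r)  ∎)
        where open ℕₚ.≤-Reasoning

    -- The coboundary of Long can be nonzero only on triangles of these two shapes.
    short-short-long-nonface : ∀ {a b c} → toℕ a < toℕ b → toℕ b < toℕ c →
      ¬ Long a b → ¬ Long b c → Long a c → ¬ Sigma r (Cycle (suc N)) (triangle a b c)
    short-short-long-nonface a<b b<c ¬ab ¬bc ac =
      triangle-nonface a<b b<c (¬Long⇒short ¬ab) (¬Long⇒short ¬bc) (Long⇒wrap-short ac)

    long-long-nonface : ∀ {a b c} → Long a b → Long b c → ¬ Sigma r (Cycle (suc N)) (triangle a b c)
    long-long-nonface {a} {b} {c} ab bc =
      triangle-nonface a<b b<c (ℕₚ.≤-trans (ℕₚ.<⇒≤ b<r) (ℕₚ.m≤n+m r (toℕ a))) c≤b+r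
        (Long⇒wrap-short (Long-extendʳ ab (ℕₚ.<⇒≤ b<c)))
      where
      a<b = Long⇒< ab
      b<c = Long⇒< bc
      c<m+r : toℕ c < m + r
      c<m+r = subst (toℕ c <_) (sym m+r≡n) (toℕ<n c)
      b<r : toℕ b < r
      b<r = ℕₚ.+-cancelʳ-< m (toℕ b) r (subst (toℕ b + m <_) (ℕₚ.+-comm m r) (ℕₚ.≤-<-trans bc c<m+r))
      c≤b+r : toℕ c ≤ toℕ b + r
      c≤b+r = ℕₚ.≤-pred (ℕₚ.≤-trans c<m+r (ℕₚ.m≤n⇒m≤1+n (ℕₚ.+-monoˡ-≤ r (ℕₚ.≤-trans (ℕₚ.m≤n+m m (toℕ a)) ab))))

    ⊥-face : Sigma r (Cycle (suc N)) ⊥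
    ⊥-face = interval-face {lo = 0} 0<r r≤n (λ x∈⊥ → contradiction x∈⊥ ∉⊥)

    closing-edge-face : Sigma r (Cycle (suc N)) (⁅ zero ⁆ ∪ ⁅ fromℕ N ⁆)
    closing-edge-face =
      interval-face {lo = 1} 0<r (ℕₚ.≤-trans (ℕₚ.n≤1+n _) (ℕₚ.≤-trans 2+r≤N (ℕₚ.n≤1+n N))) avoid
      where
      2+r≤N : 2 + r ≤ N
      2+r≤N = ℕₚ.≤-pred (subst (_≤ suc N) (ℕₚ.+-comm r 3) r+3≤n)
      avoid : ∀ {x} → x ∈ ⁅ zero ⁆ ∪ ⁅ fromℕ N ⁆ → x ∉ interval 1 (1 + r)
      avoid x∈S x∈I with ∈⁅⁆∪⁅⁆ zero (fromℕ N) x∈S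
      ... | inj₁ refl = ℕₚ.n≮0 (proj₁ (interval⁻ x∈I))
      ... | inj₂ refl = ℕₚ.<⇒≱ (proj₂ (interval⁻ x∈I))
                          (subst (suc r ≤_) (sym (toℕ-fromℕ N)) (ℕₚ.≤-trans (ℕₚ.n≤1+n _) 2+r≤N))

    path-edge-face : ∀ (j : Fin N) → Sigma r (Cycle (suc N)) (⁅ inject₁ j ⁆ ∪ ⁅ suc j ⁆)
    path-edge-face j =
      arc-face 0<r (s≤s (toℕ<n j)) (subst (λ k → k + r ≤ suc N) (sym (ℕₚ.m+n∸n≡m 2 (toℕ j))) 2+r≤n) S⊆I
      where
      2+r≤n : 2 + r ≤ suc N
      2+r≤n = ℕₚ.≤-trans (ℕₚ.≤-trans (ℕₚ.n≤1+n _) (ℕₚ.≤-reflexive (ℕₚ.+-comm 3 r))) r+3≤n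
      S⊆I : ⁅ inject₁ j ⁆ ∪ ⁅ suc j ⁆ ⊆ interval (toℕ j) (2 + toℕ j)
      S⊆I x∈S with ∈⁅⁆∪⁅⁆ (inject₁ j) (suc j) x∈S
      ... | inj₁ refl = interval⁺ (ℕₚ.≤-reflexive (sym (toℕ-inject₁ j)))
                          (subst (_< 2 + toℕ j) (sym (toℕ-inject₁ j)) (ℕₚ.m<n+m (toℕ j) (s≤s z≤n)))
      ... | inj₂ refl = interval⁺ (ℕₚ.n≤1+n _) ℕₚ.≤-refl

    v₀ v₁ v₂ : Fin (suc N)
    v₀ = zero
    v₁ = fromℕ< 1<n
    v₂ = fromℕ< 3≤n

    first-triangle-face : Sigma r (Cycle (suc N)) (triangle v₀ v₁ v₂)
    first-triangle-face = interval-face {lo = 3} 0<r (subst (_≤ suc N) (ℕₚ.+-comm r 3) r+3≤n)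
      λ x∈T x∈I → ℕₚ.<⇒≱ (below-3 x∈T) (proj₁ (interval⁻ x∈I))
      where
      below-3 : ∀ {x} → x ∈ triangle v₀ v₁ v₂ → toℕ x < 3
      below-3 x∈T with x∈p∪q⁻ (⁅ v₀ ⁆ ∪ ⁅ v₁ ⁆) ⁅ v₂ ⁆ x∈T
      ... | inj₂ x∈v₂ = subst (_< 3) (sym (trans (cong toℕ (x∈⁅y⁆⇒x≡y v₂ x∈v₂)) (toℕ-fromℕ< 3≤n))) ℕₚ.≤-refl
      ... | inj₁ x∈v₀v₁ with ∈⁅⁆∪⁅⁆ v₀ v₁ x∈v₀v₁
      ...   | inj₁ refl = s≤s z≤n
      ...   | inj₂ refl = subst (_< 3) (sym (toℕ-fromℕ< 1<n)) (s≤s (s≤s z≤n))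

    ∣first-triangle∣ : ∣ triangle v₀ v₁ v₂ ∣ ≡ 3
    ∣first-triangle∣ = trans (∣p∪⁅x⁆∣ v₂∉) (cong suc (∣⁅x⁆∪⁅y⁆∣ v₀≢v₁))
      where
      v₀≢v₁ : v₀ ≢ v₁
      v₀≢v₁ v₀≡v₁ = ℕₚ.0≢1+n (trans (cong toℕ v₀≡v₁) (toℕ-fromℕ< 1<n))
      v₂∉ : v₂ ∉ ⁅ v₀ ⁆ ∪ ⁅ v₁ ⁆
      v₂∉ v₂∈ with ∈⁅⁆∪⁅⁆ v₀ v₁ v₂∈
      ... | inj₁ v₂≡v₀ = ℕₚ.0≢1+n (trans (sym (cong toℕ v₂≡v₀)) (toℕ-fromℕ< 3≤n))
      ... | inj₂ v₂≡v₁ = ℕₚ.1+n≢n (trans (sym (toℕ-fromℕ< 3≤n)) (trans (cong toℕ v₂≡v₁) (toℕ-fromℕ< 1<n)))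

    Long-closing : Long zero (fromℕ N)
    Long-closing = subst (m ≤_) (sym (toℕ-fromℕ N)) (ℕₚ.∸-monoʳ-≤ (suc N) 0<r)

open Combinatorics

module Chains {c ℓ : Level} (K : Field c ℓ) where

  open Field K hiding (zero)
  open Homology K
  import Data.Nat.Base as ℕ
  open import Data.Fin.Base using (_<_)
  open import Data.Fin.Properties using (<⇒≢)
  open import Algebra.Properties.CommutativeSemigroup ℕₚ.+-commutativeSemigroup using (x∙yz≈y∙xz)
  open import Algebra.Properties.Ring ring
    using (-1*x≈-x; -‿involutive; -0#≈0#; x[y-z]≈xy-xz; -‿distribˡ-*)
  open import Algebra.Properties.Semiring.Sum semiring
    using (sum; sum-cong-≋; sum-replicate-zero; sum-remove; ∑-distrib-+; ∑-comm; *-distribˡ-sum)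
  open import Relation.Binary.Reasoning.Setoid setoid

  bit : Bool → ℕ
  bit b = if b then 1 else 0

  countFin-cong : ∀ {m} {f g : Fin m → Bool} → (∀ u → f u ≡ g u) → countFin f ≡ countFin g
  countFin-cong {ℕ.zero}  f≗g = ≡.refl
  countFin-cong {ℕ.suc m} f≗g = ≡.cong₂ ℕ._+_ (≡.cong bit (f≗g zero)) (countFin-cong λ u → f≗g (suc u))

  countFin-false : ∀ {m} → countFin {m} (λ _ → false) ≡ 0
  countFin-false {ℕ.zero}  = ≡.refl
  countFin-false {ℕ.suc m} = countFin-false {m}

  countFin-insert : ∀ {m} (f g : Fin m → Bool) (x : Fin m) (b : Bool) → f x ≡ false →
    (∀ u → g u ≡ (f u ∨ (does (u ≟ᶠ x) ∧ b))) → countFin g ≡ bit b ℕ.+ countFin f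
  countFin-insert f g zero b f0≡false g≗ =
    ≡.trans (≡.cong₂ (λ k l → bit k ℕ.+ l) (≡.trans (g≗ zero) (≡.cong (_∨ b) f0≡false))
              (countFin-cong λ u → ≡.trans (g≗ (suc u)) (Boolₚ.∨-identityʳ (f (suc u)))))
            (≡.cong (λ k → bit b ℕ.+ (bit k ℕ.+ countFin (λ u → f (suc u)))) (≡.sym f0≡false))
  countFin-insert f g (suc x) b fx≡false g≗ =
    ≡.trans (≡.cong₂ (λ k l → bit k ℕ.+ l) (≡.trans (g≗ zero) (Boolₚ.∨-identityʳ (f zero)))
              (countFin-insert (λ u → f (suc u)) (λ u → g (suc u)) x b fx≡false (λ u → g≗ (suc u))))
            (x∙yz≈y∙xz (bit (f zero)) (bit b) _)

  parity : ℕ → Carrier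
  parity k = if isEven k then 1# else - 1#

  parity-suc : ∀ k → parity (ℕ.suc k) ≈ - parity k
  parity-suc ℕ.zero            = refl
  parity-suc (ℕ.suc ℕ.zero)    = sym (-‿involutive 1#)
  parity-suc (ℕ.suc (ℕ.suc k)) = parity-suc k

  negateIf : Bool → Carrier → Carrier
  negateIf b x = if b then - x else x

  negateIf-cong : ∀ b {x y} → x ≈ y → negateIf b x ≈ negateIf b y
  negateIf-cong true  x≈y = -‿cong x≈y
  negateIf-cong false x≈y = x≈y

  parity-+ : ∀ b k → parity (bit b ℕ.+ k) ≈ negateIf b (parity k)
  parity-+ true  k = parity-suc k
  parity-+ false k = refl

  sign-∪⁅⁆ : ∀ {n} {H : Subset n} {x : Fin n} v → x ∉ H →
    sign (H ∪ ⁅ x ⁆) v ≈ negateIf (toℕ x ℕ.<ᵇ toℕ v) (sign H v)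
  sign-∪⁅⁆ {H = H} {x} v x∉H = begin
    parity (countFin (below (H ∪ ⁅ x ⁆)))
      ≡⟨ ≡.cong parity (countFin-insert (below H) _ x _ x-not-below below-∪) ⟩
    parity (bit (toℕ x ℕ.<ᵇ toℕ v) ℕ.+ countFin (below H))  ≈⟨ parity-+ (toℕ x ℕ.<ᵇ toℕ v) _ ⟩
    negateIf (toℕ x ℕ.<ᵇ toℕ v) (sign H v)                  ∎
    where
    below : Subset _ → Fin _ → Bool
    below G u = lookup G u ∧ (toℕ u ℕ.<ᵇ toℕ v)
    x-not-below : below H x ≡ false
    x-not-below = ≡.cong (_∧ _) (lookup-∉ x∉H)
    below-∪ : ∀ u → below (H ∪ ⁅ x ⁆) u ≡ (below H u ∨ (does (u ≟ᶠ x) ∧ (toℕ x ℕ.<ᵇ toℕ v)))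
    below-∪ u = ≡.trans
      (≡.cong (_∧ _) (≡.trans (lookup-zipWith _∨_ u H ⁅ x ⁆) (≡.cong (lookup H u ∨_) (lookup-⁅⁆ x u))))
      (≡.trans (Boolₚ.∧-distribʳ-∨ _ (lookup H u) _)
               (≡.cong (below H u ∨_) (≟-∧-subst u x λ w → toℕ w ℕ.<ᵇ toℕ v)))

  sign-⊥ : ∀ {n} (v : Fin n) → sign ⊥ v ≈ 1#
  sign-⊥ {n} v = reflexive (≡.cong parity (≡.trans
    (countFin-cong {m = n} {f = λ u → lookup ⊥ u ∧ (toℕ u ℕ.<ᵇ toℕ v)}
      λ u → ≡.cong (_∧ (toℕ u ℕ.<ᵇ toℕ v)) (lookup-replicate u false))
    (countFin-false {n})))

  sign-⁅⁆ : ∀ {n} (x v : Fin n) → sign ⁅ x ⁆ v ≈ negateIf (toℕ x ℕ.<ᵇ toℕ v) 1#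
  sign-⁅⁆ x v = begin
    sign ⁅ x ⁆ v                            ≡⟨ ≡.cong (λ G → sign G v) (≡.sym (∪-identityˡ ⁅ x ⁆)) ⟩
    sign (⊥ ∪ ⁅ x ⁆) v                      ≈⟨ sign-∪⁅⁆ v ∉⊥ ⟩
    negateIf (toℕ x ℕ.<ᵇ toℕ v) (sign ⊥ v)  ≈⟨ negateIf-cong _ (sign-⊥ v) ⟩
    negateIf (toℕ x ℕ.<ᵇ toℕ v) 1#          ∎

  x-0≈x : ∀ x → x - 0# ≈ x
  x-0≈x x = trans (+-congˡ -0#≈0#) (+-identityʳ x)

  [x-0]+0≈x : ∀ x → (x - 0#) + 0# ≈ x
  [x-0]+0≈x x = trans (+-identityʳ _) (x-0≈x x)

  [0-x]+0≈-x : ∀ x → (0# - x) + 0# ≈ - x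
  [0-x]+0≈-x x = trans (+-identityʳ _) (+-identityˡ (- x))

  [0-0]+x≈x : ∀ x → (0# - 0#) + x ≈ x
  [0-0]+x≈x x = trans (+-congʳ (-‿inverseʳ 0#)) (+-identityˡ x)

  sumFin≡sum : ∀ {m} (f : Fin m → Carrier) → sumFin f ≡ sum f
  sumFin≡sum {ℕ.zero}  f = ≡.refl
  sumFin≡sum {ℕ.suc m} f = ≡.cong (f zero +_) (sumFin≡sum (λ i → f (suc i)))

  sum-zero : ∀ {m} {f : Fin m → Carrier} → (∀ i → f i ≈ 0#) → sum f ≈ 0#
  sum-zero {m} f≈0 = trans (sum-cong-≋ f≈0) (sum-replicate-zero m)

  sum-single : ∀ {m} {f : Fin m → Carrier} i → (∀ j → j ≢ i → f j ≈ 0#) → sum f ≈ f i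
  sum-single {ℕ.suc m} {f} i others = begin
    sum f                              ≈⟨ sum-remove {i = i} f ⟩
    f i + sum (λ j → f (punchIn i j))  ≈⟨ +-congˡ (sum-zero λ j → others (punchIn i j) (punchInᵢ≢i i j)) ⟩
    f i + 0#                           ≈⟨ +-identityʳ (f i) ⟩
    f i                                ∎

  sum-neg : ∀ {m} (f : Fin m → Carrier) → sum (λ i → - f i) ≈ - sum f
  sum-neg f = begin
    sum (λ i → - f i)       ≈⟨ sum-cong-≋ (λ i → sym (-1*x≈-x (f i))) ⟩
    sum (λ i → - 1# * f i)  ≈⟨ *-distribˡ-sum (- 1#) f ⟨
    - 1# * sum f            ≈⟨ -1*x≈-x (sum f) ⟩
    - sum f                 ∎

  sum-sub : ∀ {m} (f g : Fin m → Carrier) → sum (λ i → f i - g i) ≈ sum f - sum g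
  sum-sub f g = trans (∑-distrib-+ f (λ i → - g i)) (+-congˡ (sum-neg g))

  sum-telescope : ∀ {N} (f : Fin (ℕ.suc N) → Carrier) →
    sum (λ j → f (suc j) - f (inject₁ j)) ≈ f (fromℕ N) - f zero
  sum-telescope {ℕ.zero}  f = sym (-‿inverseʳ (f zero))
  sum-telescope {ℕ.suc N} f = begin
    (f (suc zero) - f zero) + sum (λ j → f (suc (suc j)) - f (suc (inject₁ j)))
      ≈⟨ +-congˡ (sum-telescope (λ i → f (suc i))) ⟩
    (f (suc zero) - f zero) + (f (fromℕ (ℕ.suc N)) - f (suc zero))
      ≈⟨ +-comm _ _ ⟩
    (f (fromℕ (ℕ.suc N)) - f (suc zero)) + (f (suc zero) - f zero)
      ≈⟨ +-assoc _ _ _ ⟩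
    f (fromℕ (ℕ.suc N)) + (- f (suc zero) + (f (suc zero) - f zero))
      ≈⟨ +-congˡ (trans (sym (+-assoc _ _ _)) (trans (+-congʳ (-‿inverseˡ _)) (+-identityˡ _))) ⟩
    f (fromℕ (ℕ.suc N)) - f zero ∎

  ∂-term : ∀ {n} → (Subset n → Carrier) → Subset n → Fin n → Carrier
  ∂-term f H v = if lookup H v then 0# else sign H v * f (H ∪ ⁅ v ⁆)

  ∂≈sum-∂-term : ∀ {n} (f : Subset n → Carrier) H → ∂ f H ≈ sum (∂-term f H)
  ∂≈sum-∂-term f H = reflexive (sumFin≡sum (∂-term f H))

  ∂-term-∈ : ∀ {n} (f : Subset n → Carrier) {H : Subset n} {v} → v ∈ H → ∂-term f H v ≈ 0#
  ∂-term-∈ f {H} {v} v∈H rewrite []=⇒lookup v∈H = refl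

  ∂-term-∉ : ∀ {n} (f : Subset n → Carrier) {H : Subset n} {v} → v ∉ H → ∂-term f H v ≈ sign H v * f (H ∪ ⁅ v ⁆)
  ∂-term-∉ f {H} {v} v∉H rewrite lookup-∉ v∉H = refl

  ∂-sub : ∀ {n} (f g : Subset n → Carrier) H → ∂ (λ G → f G - g G) H ≈ ∂ f H - ∂ g H
  ∂-sub f g H = begin
    ∂ (λ G → f G - g G) H                    ≈⟨ ∂≈sum-∂-term (λ G → f G - g G) H ⟩
    sum (∂-term (λ G → f G - g G) H)         ≈⟨ sum-cong-≋ ∂-term-sub ⟩
    sum (λ v → ∂-term f H v - ∂-term g H v)  ≈⟨ sum-sub (∂-term f H) (∂-term g H) ⟩
    sum (∂-term f H) - sum (∂-term g H)      ≈⟨ -‿cong₂ (∂≈sum-∂-term f H) (∂≈sum-∂-term g H) ⟨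
    ∂ f H - ∂ g H                            ∎
    where
    -‿cong₂ : ∀ {a b c d} → a ≈ b → c ≈ d → a - c ≈ b - d
    -‿cong₂ a≈b c≈d = +-cong a≈b (-‿cong c≈d)
    ∂-term-sub : ∀ v → ∂-term (λ G → f G - g G) H v ≈ ∂-term f H v - ∂-term g H v
    ∂-term-sub v with v ∈? H
    ... | yes v∈H = begin
      ∂-term (λ G → f G - g G) H v  ≈⟨ ∂-term-∈ (λ G → f G - g G) v∈H ⟩
      0#                            ≈⟨ -‿inverseʳ 0# ⟨
      0# - 0#                       ≈⟨ -‿cong₂ (∂-term-∈ f v∈H) (∂-term-∈ g v∈H) ⟨
      ∂-term f H v - ∂-term g H v   ∎
    ... | no v∉H = begin
      ∂-term (λ G → f G - g G) H v                         ≈⟨ ∂-term-∉ (λ G → f G - g G) v∉H ⟩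
      sign H v * (f (H ∪ ⁅ v ⁆) - g (H ∪ ⁅ v ⁆))           ≈⟨ x[y-z]≈xy-xz _ _ _ ⟩
      sign H v * f (H ∪ ⁅ v ⁆) - sign H v * g (H ∪ ⁅ v ⁆)  ≈⟨ -‿cong₂ (∂-term-∉ f v∉H) (∂-term-∉ g v∉H) ⟨
      ∂-term f H v - ∂-term g H v                          ∎

  ∂-sum : ∀ {n m} (h : Fin m → Subset n → Carrier) H → ∂ (λ G → sum (λ i → h i G)) H ≈ sum (λ i → ∂ (h i) H)
  ∂-sum h H = begin
    ∂ (λ G → sum (λ i → h i G)) H             ≈⟨ ∂≈sum-∂-term (λ G → sum (λ i → h i G)) H ⟩
    sum (∂-term (λ G → sum (λ i → h i G)) H)  ≈⟨ sum-cong-≋ ∂-term-sum ⟩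
    sum (λ v → sum (λ i → ∂-term (h i) H v))  ≈⟨ ∑-comm (λ v i → ∂-term (h i) H v) ⟩
    sum (λ i → sum (∂-term (h i) H))          ≈⟨ sum-cong-≋ (λ i → ∂≈sum-∂-term (h i) H) ⟨
    sum (λ i → ∂ (h i) H)                     ∎
    where
    ∂-term-sum : ∀ v → ∂-term (λ G → sum (λ i → h i G)) H v ≈ sum (λ i → ∂-term (h i) H v)
    ∂-term-sum v with v ∈? H
    ... | yes v∈H = trans (∂-term-∈ (λ G → sum (λ i → h i G)) v∈H) (sym (sum-zero λ i → ∂-term-∈ (h i) v∈H))
    ... | no v∉H = begin
      ∂-term (λ G → sum (λ i → h i G)) H v    ≈⟨ ∂-term-∉ (λ G → sum (λ i → h i G)) v∉H ⟩
      sign H v * sum (λ i → h i (H ∪ ⁅ v ⁆))  ≈⟨ *-distribˡ-sum (sign H v) (λ i → h i (H ∪ ⁅ v ⁆)) ⟩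
      sum (λ i → sign H v * h i (H ∪ ⁅ v ⁆))  ≈⟨ sum-cong-≋ (λ i → ∂-term-∉ (h i) v∉H) ⟨
      sum (λ i → ∂-term (h i) H v)            ∎

  basis : ∀ {n} → Subset n → Subset n → Carrier
  basis S G = if does (G ≟ˢ S) then 1# else 0#

  basis-self : ∀ {n} (S : Subset n) → basis S S ≈ 1#
  basis-self S with S ≟ˢ S
  ... | yes _   = refl
  ... | no  S≢S = contradiction ≡.refl S≢S

  basis-other : ∀ {n} {S G : Subset n} → G ≢ S → basis S G ≈ 0#
  basis-other {S = S} {G} G≢S with G ≟ˢ S
  ... | yes G≡S = contradiction G≡S G≢S
  ... | no  _   = refl

  ∂-basis-∪⁅⁆ : ∀ {n} {H : Subset n} {v} → v ∉ H → ∂ (basis (H ∪ ⁅ v ⁆)) H ≈ sign H v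
  ∂-basis-∪⁅⁆ {H = H} {v} v∉H = begin
    ∂ (basis (H ∪ ⁅ v ⁆)) H                   ≈⟨ ∂≈sum-∂-term (basis (H ∪ ⁅ v ⁆)) H ⟩
    sum (∂-term (basis (H ∪ ⁅ v ⁆)) H)        ≈⟨ sum-single v others ⟩
    ∂-term (basis (H ∪ ⁅ v ⁆)) H v            ≈⟨ ∂-term-∉ (basis (H ∪ ⁅ v ⁆)) v∉H ⟩
    sign H v * basis (H ∪ ⁅ v ⁆) (H ∪ ⁅ v ⁆)  ≈⟨ *-congˡ (basis-self (H ∪ ⁅ v ⁆)) ⟩
    sign H v * 1#                             ≈⟨ *-identityʳ (sign H v) ⟩
    sign H v                                  ∎
    where
    others : ∀ w → w ≢ v → ∂-term (basis (H ∪ ⁅ v ⁆)) H w ≈ 0#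
    others w w≢v with w ∈? H
    ... | yes w∈H = ∂-term-∈ (basis (H ∪ ⁅ v ⁆)) w∈H
    ... | no  w∉H = trans (∂-term-∉ (basis (H ∪ ⁅ v ⁆)) w∉H) (trans (*-congˡ (basis-other different)) (zeroʳ _))
      where
      different : H ∪ ⁅ w ⁆ ≢ H ∪ ⁅ v ⁆
      different eq with x∈p∪q⁻ H ⁅ v ⁆ (≡.subst (w ∈_) eq (x∈p∪q⁺ (inj₂ (x∈⁅x⁆ w))))
      ... | inj₁ w∈H = w∉H w∈H
      ... | inj₂ w∈v = w≢v (x∈⁅y⁆⇒x≡y v w∈v)

  ∂-basis-unreachable : ∀ {n} {H S : Subset n} → (∀ {v} → v ∉ H → H ∪ ⁅ v ⁆ ≢ S) → ∂ (basis S) H ≈ 0#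
  ∂-basis-unreachable {H = H} {S} unreachable = trans (∂≈sum-∂-term (basis S) H) (sum-zero vanish)
    where
    vanish : ∀ v → ∂-term (basis S) H v ≈ 0#
    vanish v with v ∈? H
    ... | yes v∈H = ∂-term-∈ (basis S) v∈H
    ... | no  v∉H = trans (∂-term-∉ (basis S) v∉H) (trans (*-congˡ (basis-other (unreachable v∉H))) (zeroʳ _))

  ∂-basis-⁅⁆ : ∀ {n} (p : Fin n) H → ∂ (basis ⁅ p ⁆) H ≈ basis ⊥ H
  ∂-basis-⁅⁆ {n} p H = by-cases (H ≟ˢ ⊥)
    where
    by-cases : Dec (H ≡ ⊥) → ∂ (basis ⁅ p ⁆) H ≈ basis ⊥ H
    by-cases (yes ≡.refl) = begin
      ∂ (basis ⁅ p ⁆) ⊥        ≡⟨ ≡.cong (λ S → ∂ (basis S) ⊥) (≡.sym (∪-identityˡ ⁅ p ⁆)) ⟩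
      ∂ (basis (⊥ ∪ ⁅ p ⁆)) ⊥  ≈⟨ ∂-basis-∪⁅⁆ {H = ⊥} {v = p} ∉⊥ ⟩
      sign ⊥ p                 ≈⟨ sign-⊥ p ⟩
      1#                       ≈⟨ basis-self (⊥ {n}) ⟨
      basis (⊥ {n}) ⊥          ∎
    by-cases (no H≢⊥) = trans (∂-basis-unreachable only-from-⊥) (sym (basis-other H≢⊥))
      where
      only-from-⊥ : ∀ {v} → v ∉ H → H ∪ ⁅ v ⁆ ≢ ⁅ p ⁆
      only-from-⊥ {v} v∉H eq with x∈⁅y⁆⇒x≡y p (≡.subst (v ∈_) eq (x∈p∪q⁺ (inj₂ (x∈⁅x⁆ v))))
      ... | ≡.refl = H≢⊥ (∪-⁅⁆-cancel v∉H ∉⊥ (≡.trans eq (≡.sym (∪-identityˡ ⁅ v ⁆))))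

  ∂-basis-edge : ∀ {n} {x y : Fin n} → x < y → ∀ H → ∂ (basis (⁅ x ⁆ ∪ ⁅ y ⁆)) H ≈ basis ⁅ y ⁆ H - basis ⁅ x ⁆ H
  ∂-basis-edge {x = x} {y} x<y H = by-cases (H ≟ˢ ⁅ y ⁆) (H ≟ˢ ⁅ x ⁆)
    where
    x≢y : x ≢ y
    x≢y = <⇒≢ x<y
    y≢x : y ≢ x
    y≢x = x≢y ∘ ≡.sym
    by-cases : Dec (H ≡ ⁅ y ⁆) → Dec (H ≡ ⁅ x ⁆) → ∂ (basis (⁅ x ⁆ ∪ ⁅ y ⁆)) H ≈ basis ⁅ y ⁆ H - basis ⁅ x ⁆ H
    by-cases (yes ≡.refl) _ = begin
      ∂ (basis (⁅ x ⁆ ∪ ⁅ y ⁆)) ⁅ y ⁆        ≡⟨ ≡.cong (λ S → ∂ (basis S) ⁅ y ⁆) (∪-comm ⁅ x ⁆ ⁅ y ⁆) ⟩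
      ∂ (basis (⁅ y ⁆ ∪ ⁅ x ⁆)) ⁅ y ⁆        ≈⟨ ∂-basis-∪⁅⁆ (x≢y⇒x∉⁅y⁆ x≢y) ⟩
      sign ⁅ y ⁆ x                           ≈⟨ sign-⁅⁆ y x ⟩
      negateIf (toℕ y ℕ.<ᵇ toℕ x) 1#         ≡⟨ ≡.cong (λ b → negateIf b 1#) (<ᵇ≡false (ℕₚ.<⇒≤ x<y)) ⟩
      1#                                     ≈⟨ x-0≈x 1# ⟨
      1# - 0#                                ≈⟨ +-cong (basis-self ⁅ y ⁆)
                                                         (-‿cong (basis-other (x≢y⇒⁅x⁆≢⁅y⁆ y≢x))) ⟨
      basis ⁅ y ⁆ ⁅ y ⁆ - basis ⁅ x ⁆ ⁅ y ⁆  ∎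
    by-cases (no _) (yes ≡.refl) = begin
      ∂ (basis (⁅ x ⁆ ∪ ⁅ y ⁆)) ⁅ x ⁆        ≈⟨ ∂-basis-∪⁅⁆ (x≢y⇒x∉⁅y⁆ y≢x) ⟩
      sign ⁅ x ⁆ y                           ≈⟨ sign-⁅⁆ x y ⟩
      negateIf (toℕ x ℕ.<ᵇ toℕ y) 1#         ≡⟨ ≡.cong (λ b → negateIf b 1#) (<ᵇ≡true x<y) ⟩
      - 1#                                   ≈⟨ +-identityˡ (- 1#) ⟨
      0# - 1#                                ≈⟨ +-cong (basis-other (x≢y⇒⁅x⁆≢⁅y⁆ x≢y))
                                                         (-‿cong (basis-self ⁅ x ⁆)) ⟨
      basis ⁅ y ⁆ ⁅ x ⁆ - basis ⁅ x ⁆ ⁅ x ⁆  ∎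
    by-cases (no H≢y) (no H≢x) = begin
      ∂ (basis (⁅ x ⁆ ∪ ⁅ y ⁆)) H    ≈⟨ ∂-basis-unreachable only-from-vertices ⟩
      0#                             ≈⟨ -‿inverseʳ 0# ⟨
      0# - 0#                        ≈⟨ +-cong (basis-other H≢y) (-‿cong (basis-other H≢x)) ⟨
      basis ⁅ y ⁆ H - basis ⁅ x ⁆ H  ∎
      where
      only-from-vertices : ∀ {v} → v ∉ H → H ∪ ⁅ v ⁆ ≢ ⁅ x ⁆ ∪ ⁅ y ⁆
      only-from-vertices {v} v∉H eq with ∈⁅⁆∪⁅⁆ x y (≡.subst (v ∈_) eq (x∈p∪q⁺ (inj₂ (x∈⁅x⁆ v))))
      ... | inj₁ ≡.refl = H≢y (∪-⁅⁆-cancel v∉H (x≢y⇒x∉⁅y⁆ x≢y) (≡.trans eq (∪-comm ⁅ x ⁆ ⁅ y ⁆)))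
      ... | inj₂ ≡.refl = H≢x (∪-⁅⁆-cancel v∉H (x≢y⇒x∉⁅y⁆ y≢x) eq)

  when : ∀ {p} {P : Set p} → Dec P → Carrier → Carrier
  when d x = if does d then x else 0#

  when-yes : ∀ {p} {P : Set p} (d : Dec P) {x} → P → when d x ≈ x
  when-yes (yes _) _  = refl
  when-yes (no ¬p) p = contradiction p ¬p

  when-no : ∀ {p} {P : Set p} (d : Dec P) {x} → ¬ P → when d x ≈ 0#
  when-no (yes p) ¬p = contradiction p ¬p
  when-no (no _)  _  = refl

  when-0 : ∀ {p} {P : Set p} (d : Dec P) {x} → (P → x ≈ 0#) → when d x ≈ 0#
  when-0 (yes p) x≈0 = x≈0 p
  when-0 (no _)  _   = refl

  when-cong : ∀ {p} {P : Set p} (d : Dec P) {x y} → (P → x ≈ y) → when d x ≈ when d y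
  when-cong (yes p) x≈y = x≈y p
  when-cong (no _)  _   = refl

  when-sum : ∀ {p} {P : Set p} (d : Dec P) {m} (f : Fin m → Carrier) → when d (sum f) ≈ sum (λ i → when d (f i))
  when-sum (yes _) f = refl
  when-sum (no _)  {m} f = sym (sum-zero {m} {λ _ → 0#} λ _ → refl)

  ∑∑-antisymmetric : ∀ {m} (A : Fin m → Fin m → Carrier) → (∀ i j → A i j ≈ - A j i) → (∀ i → A i i ≈ 0#) →
    sum (λ i → sum (λ j → A i j)) ≈ 0#
  ∑∑-antisymmetric {ℕ.zero}  A anti diag = refl
  ∑∑-antisymmetric {ℕ.suc m} A anti diag = begin
    (A zero zero + X) + sum (λ i → A (suc i) zero + sum (λ j → A (suc i) (suc j)))
      ≈⟨ +-cong (+-congʳ (diag zero)) (∑-distrib-+ (λ i → A (suc i) zero) _) ⟩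
    (0# + X) + (Y + sum (λ i → sum (λ j → A (suc i) (suc j))))
      ≈⟨ +-cong (+-identityˡ X) (+-congˡ (∑∑-antisymmetric (λ i j → A (suc i) (suc j))
                                                            (λ i j → anti (suc i) (suc j)) (diag ∘ suc))) ⟩
    X + (Y + 0#)
      ≈⟨ +-congˡ (+-identityʳ Y) ⟩
    X + Y
      ≈⟨ ∑-distrib-+ (λ j → A zero (suc j)) (λ j → A (suc j) zero) ⟨
    sum (λ j → A zero (suc j) + A (suc j) zero)
      ≈⟨ sum-zero (λ j → trans (+-congʳ (anti zero (suc j))) (-‿inverseˡ _)) ⟩
    0# ∎
    where
    X = sum (λ j → A zero (suc j))
    Y = sum (λ i → A (suc i) zero)

  sign-⁅⁆-antisym : ∀ {n} {u v : Fin n} → u ≢ v → sign ⁅ u ⁆ v ≈ - sign ⁅ v ⁆ u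
  sign-⁅⁆-antisym {u = u} {v} u≢v with ℕₚ.<-cmp (toℕ u) (toℕ v)
  ... | tri< u<v _ _ = begin
    sign ⁅ u ⁆ v                      ≈⟨ sign-⁅⁆ u v ⟩
    negateIf (toℕ u ℕ.<ᵇ toℕ v) 1#    ≡⟨ ≡.cong₂ (λ b c → negateIf b (negateIf c 1#))
                                                 (<ᵇ≡true u<v) (≡.sym (<ᵇ≡false (ℕₚ.<⇒≤ u<v))) ⟩
    - negateIf (toℕ v ℕ.<ᵇ toℕ u) 1#  ≈⟨ -‿cong (sign-⁅⁆ v u) ⟨
    - sign ⁅ v ⁆ u                    ∎
  ... | tri≈ _ u≡v _ = contradiction (toℕ-injective u≡v) u≢v
  ... | tri> _ _ v<u = begin
    sign ⁅ u ⁆ v                      ≈⟨ sign-⁅⁆ u v ⟩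
    negateIf (toℕ u ℕ.<ᵇ toℕ v) 1#    ≡⟨ ≡.cong (λ b → negateIf b 1#) (<ᵇ≡false (ℕₚ.<⇒≤ v<u)) ⟩
    1#                                ≈⟨ -‿involutive 1# ⟨
    - - 1#                            ≡⟨ ≡.cong (λ b → - negateIf b 1#) (≡.sym (<ᵇ≡true v<u)) ⟩
    - negateIf (toℕ v ℕ.<ᵇ toℕ u) 1#  ≈⟨ -‿cong (sign-⁅⁆ v u) ⟨
    - sign ⁅ v ⁆ u                    ∎

  ⟨_,_⟩₀ : ∀ {n} → Subset n → (Subset n → Carrier) → Carrier
  ⟨ C , f ⟩₀ = sum λ u → when (u ∈? C) (f ⁅ u ⁆)

  ⟨⟩₀-cong : ∀ {n} (C : Subset n) {f g : Subset n → Carrier} → (∀ G → f G ≈ g G) → ⟨ C , f ⟩₀ ≈ ⟨ C , g ⟩₀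
  ⟨⟩₀-cong C f≈g = sum-cong-≋ λ u → when-cong (u ∈? C) (λ _ → f≈g ⁅ u ⁆)

  ⟨⟩₀-∂ : ∀ {n} (C : Subset n) (β : Subset n → Carrier) →
    (∀ {u v} → u ∈ C → v ∉ C → β (⁅ u ⁆ ∪ ⁅ v ⁆) ≈ 0#) → ⟨ C , ∂ β ⟩₀ ≈ 0#
  ⟨⟩₀-∂ C β crossing = begin
    sum (λ u → when (u ∈? C) (∂ β ⁅ u ⁆))  ≈⟨ sum-cong-≋ expand ⟩
    sum (λ u → sum (λ v → A u v))          ≈⟨ ∑∑-antisymmetric A anti diag ⟩
    0#                                     ∎
    where
    A : Fin _ → Fin _ → Carrier
    A u v = when (u ∈? C) (when (v ∈? C) (∂-term β ⁅ u ⁆ v))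
    expand : ∀ u → when (u ∈? C) (∂ β ⁅ u ⁆) ≈ sum (λ v → A u v)
    expand u = trans (when-cong (u ∈? C) (λ _ → ∂≈sum-∂-term β ⁅ u ⁆))
                     (trans (when-sum (u ∈? C) (∂-term β ⁅ u ⁆)) (sum-cong-≋ cross-terms-vanish))
      where
      cross-terms-vanish : ∀ v → when (u ∈? C) (∂-term β ⁅ u ⁆ v) ≈ A u v
      cross-terms-vanish v with u ∈? C | v ∈? C
      ... | no  _   | _       = refl
      ... | yes _   | yes _   = refl
      ... | yes u∈C | no  v∉C with v ∈? ⁅ u ⁆
      ...   | yes v∈u = ∂-term-∈ β v∈u
      ...   | no  v∉u = trans (∂-term-∉ β v∉u) (trans (*-congˡ (crossing u∈C v∉C)) (zeroʳ _))
    diag : ∀ u → A u u ≈ 0#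
    diag u = when-0 (u ∈? C) (λ _ → when-0 (u ∈? C) (λ _ → ∂-term-∈ β (x∈⁅x⁆ u)))
    anti : ∀ u v → A u v ≈ - A v u
    anti u v with u ∈? C | v ∈? C
    ... | no  _ | no  _ = sym -0#≈0#
    ... | no  _ | yes _ = sym -0#≈0#
    ... | yes _ | no  _ = sym -0#≈0#
    ... | yes _ | yes _ with u ≟ᶠ v
    ...   | yes ≡.refl = trans (∂-term-∈ β (x∈⁅x⁆ u)) (sym (trans (-‿cong (∂-term-∈ β (x∈⁅x⁆ u))) -0#≈0#))
    ...   | no  u≢v = begin
      ∂-term β ⁅ u ⁆ v                      ≈⟨ ∂-term-∉ β (x≢y⇒x∉⁅y⁆ (λ v≡u → u≢v (≡.sym v≡u))) ⟩
      sign ⁅ u ⁆ v * β (⁅ u ⁆ ∪ ⁅ v ⁆)      ≈⟨ *-cong (sign-⁅⁆-antisym u≢v)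
                                                        (reflexive (≡.cong β (∪-comm ⁅ u ⁆ ⁅ v ⁆))) ⟩
      - sign ⁅ v ⁆ u * β (⁅ v ⁆ ∪ ⁅ u ⁆)    ≈⟨ -‿distribˡ-* _ _ ⟨
      - (sign ⁅ v ⁆ u * β (⁅ v ⁆ ∪ ⁅ u ⁆))  ≈⟨ -‿cong (∂-term-∉ β (x≢y⇒x∉⁅y⁆ u≢v)) ⟨
      - ∂-term β ⁅ v ⁆ u                    ∎

  sign-edge : ∀ {n} {x y : Fin n} → x ≢ y → ∀ v →
    sign (⁅ x ⁆ ∪ ⁅ y ⁆) v ≈ negateIf (toℕ y ℕ.<ᵇ toℕ v) (negateIf (toℕ x ℕ.<ᵇ toℕ v) 1#)
  sign-edge {x = x} {y} x≢y v =
    trans (sign-∪⁅⁆ v (x≢y⇒x∉⁅y⁆ (x≢y ∘ ≡.sym))) (negateIf-cong (toℕ y ℕ.<ᵇ toℕ v) (sign-⁅⁆ x v))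

  -- The sign is - when v lies between x and y, and + when v lies outside [x, y].
  ∂-term-edge : ∀ {n} (β : Subset n → Carrier) {x y : Fin n} → x < y → ∀ v →
    ∂-term β (⁅ x ⁆ ∪ ⁅ y ⁆) v ≈
      (when (v <? x) (β (triangle x y v)) - when (x <? v) (when (v <? y) (β (triangle x y v))))
        + when (y <? v) (β (triangle x y v))
  ∂-term-edge β {x} {y} x<y v = by-position (ℕₚ.<-cmp (toℕ v) (toℕ x)) (ℕₚ.<-cmp (toℕ v) (toℕ y))
    where
    t = β (triangle x y v)
    expansion = (when (v <? x) t - when (x <? v) (when (v <? y) t)) + when (y <? v) t
    [x<v] [y<v] : Bool
    [x<v] = toℕ x ℕ.<ᵇ toℕ v
    [y<v] = toℕ y ℕ.<ᵇ toℕ v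
    signed : Bool → Bool → Carrier
    signed b c = negateIf b (negateIf c 1#) * t
    off-edge : toℕ v ≢ toℕ x → toℕ v ≢ toℕ y → ∂-term β (⁅ x ⁆ ∪ ⁅ y ⁆) v ≈ signed [y<v] [x<v]
    off-edge v≢x v≢y = trans (∂-term-∉ β v∉xy) (*-congʳ (sign-edge (<⇒≢ x<y) v))
      where
      v∉xy : v ∉ ⁅ x ⁆ ∪ ⁅ y ⁆
      v∉xy v∈xy = [ v≢x ∘ ≡.cong toℕ , v≢y ∘ ≡.cong toℕ ]′ (∈⁅⁆∪⁅⁆ x y v∈xy)
    by-position : Tri (toℕ v ℕ.< toℕ x) (toℕ v ≡ toℕ x) (toℕ x ℕ.< toℕ v) →
                  Tri (toℕ v ℕ.< toℕ y) (toℕ v ≡ toℕ y) (toℕ y ℕ.< toℕ v) →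
      ∂-term β (⁅ x ⁆ ∪ ⁅ y ⁆) v ≈ expansion
    expansion-≈ : ∀ {a b c} → when (v <? x) t ≈ a → when (x <? v) (when (v <? y) t) ≈ b → when (y <? v) t ≈ c →
      expansion ≈ (a - b) + c
    expansion-≈ a≈ b≈ c≈ = +-cong (+-cong a≈ (-‿cong b≈)) c≈
    by-position (tri< v<x _ _) _ = begin
      ∂-term β (⁅ x ⁆ ∪ ⁅ y ⁆) v  ≈⟨ off-edge (ℕₚ.<⇒≢ v<x) (ℕₚ.<⇒≢ v<y) ⟩
      signed [y<v] [x<v]          ≡⟨ ≡.cong₂ signed (<ᵇ≡false (ℕₚ.<⇒≤ v<y)) (<ᵇ≡false (ℕₚ.<⇒≤ v<x)) ⟩
      1# * t                      ≈⟨ *-identityˡ t ⟩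
      t                           ≈⟨ [x-0]+0≈x t ⟨
      (t - 0#) + 0#               ≈⟨ expansion-≈ (when-yes (v <? x) v<x) (when-no (x <? v) (ℕₚ.<⇒≯ v<x))
                                                 (when-no (y <? v) (ℕₚ.<⇒≯ v<y)) ⟨
      expansion                   ∎
      where v<y = ℕₚ.<-trans v<x x<y
    by-position (tri≈ _ v≡x _) _ = begin
      ∂-term β (⁅ x ⁆ ∪ ⁅ y ⁆) v  ≈⟨ ∂-term-∈ β (x∈p∪q⁺ (inj₁ (≡.subst (_∈ ⁅ x ⁆) v≡x′ (x∈⁅x⁆ x)))) ⟩
      0#                          ≈⟨ [0-0]+x≈x 0# ⟨
      (0# - 0#) + 0#              ≈⟨ expansion-≈ (when-no (v <? x) (ℕₚ.<-irrefl v≡x))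
                                                 (when-no (x <? v) (ℕₚ.<-irrefl (≡.sym v≡x)))
                                                 (when-no (y <? v) (ℕₚ.<⇒≯ (≡.subst (ℕ._< toℕ y) (≡.sym v≡x) x<y))) ⟨
      expansion                   ∎
      where v≡x′ = ≡.sym (toℕ-injective v≡x)
    by-position (tri> _ _ x<v) (tri< v<y _ _) = begin
      ∂-term β (⁅ x ⁆ ∪ ⁅ y ⁆) v  ≈⟨ off-edge (ℕₚ.>⇒≢ x<v) (ℕₚ.<⇒≢ v<y) ⟩
      signed [y<v] [x<v]          ≡⟨ ≡.cong₂ signed (<ᵇ≡false (ℕₚ.<⇒≤ v<y)) (<ᵇ≡true x<v) ⟩
      - 1# * t                    ≈⟨ -1*x≈-x t ⟩
      - t                         ≈⟨ [0-x]+0≈-x t ⟨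
      (0# - t) + 0#               ≈⟨ expansion-≈ (when-no (v <? x) (ℕₚ.<⇒≯ x<v))
                                                 (trans (when-yes (x <? v) x<v) (when-yes (v <? y) v<y))
                                                 (when-no (y <? v) (ℕₚ.<⇒≯ v<y)) ⟨
      expansion                   ∎
    by-position (tri> _ _ x<v) (tri≈ _ v≡y _) = begin
      ∂-term β (⁅ x ⁆ ∪ ⁅ y ⁆) v  ≈⟨ ∂-term-∈ β (x∈p∪q⁺ {p = ⁅ x ⁆} (inj₂ (≡.subst (_∈ ⁅ y ⁆) v≡y′ (x∈⁅x⁆ y)))) ⟩
      0#                          ≈⟨ [0-0]+x≈x 0# ⟨
      (0# - 0#) + 0#              ≈⟨ expansion-≈ (when-no (v <? x) (ℕₚ.<⇒≯ x<v))
                                                 (trans (when-yes (x <? v) x<v) (when-no (v <? y) (ℕₚ.<-irrefl v≡y)))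
                                                 (when-no (y <? v) (ℕₚ.<-irrefl (≡.sym v≡y))) ⟨
      expansion                   ∎
      where v≡y′ = ≡.sym (toℕ-injective v≡y)
    by-position (tri> _ _ x<v) (tri> _ _ y<v) = begin
      ∂-term β (⁅ x ⁆ ∪ ⁅ y ⁆) v  ≈⟨ off-edge (ℕₚ.>⇒≢ x<v) (ℕₚ.>⇒≢ y<v) ⟩
      signed [y<v] [x<v]          ≡⟨ ≡.cong₂ signed (<ᵇ≡true y<v) (<ᵇ≡true x<v) ⟩
      - - 1# * t                  ≈⟨ *-congʳ (-‿involutive 1#) ⟩
      1# * t                      ≈⟨ *-identityˡ t ⟩
      t                           ≈⟨ [0-0]+x≈x t ⟨
      (0# - 0#) + t               ≈⟨ expansion-≈ (when-no (v <? x) (ℕₚ.<⇒≯ x<v))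
                                                 (trans (when-yes (x <? v) x<v) (when-no (v <? y) (ℕₚ.<⇒≯ y<v)))
                                                 (when-yes (y <? v) y<v) ⟨
      expansion                   ∎

  sum₃ : ∀ {n} → (Fin n → Fin n → Fin n → Carrier) → Carrier
  sum₃ f = sum λ a → sum λ b → sum λ c → f a b c

  sum₃-[-]+ : ∀ {n} (f g h : Fin n → Fin n → Fin n → Carrier) →
    sum₃ (λ a b c → (f a b c - g a b c) + h a b c) ≈ (sum₃ f - sum₃ g) + sum₃ h
  sum₃-[-]+ f g h = trans (sum-cong-≋ λ a → trans (sum-cong-≋ λ b → [-]+ (f a b) (g a b) (h a b))
                                                  ([-]+ (sum ∘ f a) (sum ∘ g a) (sum ∘ h a)))
                          ([-]+ (sum₂ f) (sum₂ g) (sum₂ h))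
    where
    sum₂ : (Fin _ → Fin _ → Fin _ → Carrier) → Fin _ → Carrier
    sum₂ f a = sum λ b → sum λ c → f a b c
    [-]+ : ∀ {m} (f g h : Fin m → Carrier) → sum (λ i → (f i - g i) + h i) ≈ (sum f - sum g) + sum h
    [-]+ f g h = trans (∑-distrib-+ (λ i → f i - g i) h) (+-congʳ (sum-sub f g))

  sum₃-rotate : ∀ {n} (f : Fin n → Fin n → Fin n → Carrier) → sum₃ f ≈ sum₃ (λ a b c → f b c a)
  sum₃-rotate f = sym (trans (∑-comm (λ a b → sum λ c → f b c a)) (sum-cong-≋ λ b → ∑-comm (λ a c → f b c a)))

  sum₃-swap : ∀ {n} (f : Fin n → Fin n → Fin n → Carrier) → sum₃ f ≈ sum₃ (λ a b c → f a c b)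
  sum₃-swap f = sum-cong-≋ λ a → ∑-comm (λ b c → f a b c)

  ⟨_,_⟩₁ : ∀ {n} {R : Fin n → Fin n → Set} → (∀ x y → Dec (R x y)) → (Subset n → Carrier) → Carrier
  ⟨ R? , f ⟩₁ = sum λ x → sum λ y → when (R? x y) (f (⁅ x ⁆ ∪ ⁅ y ⁆))

  ⟨⟩₁-cong : ∀ {n} {R : Fin n → Fin n → Set} (R? : ∀ x y → Dec (R x y)) {f g : Subset n → Carrier} →
    (∀ G → f G ≈ g G) → ⟨ R? , f ⟩₁ ≈ ⟨ R? , g ⟩₁
  ⟨⟩₁-cong R? f≈g = sum-cong-≋ λ x → sum-cong-≋ λ y → when-cong (R? x y) (λ _ → f≈g (⁅ x ⁆ ∪ ⁅ y ⁆))

  δ-term : ∀ {n} {R : Fin n → Fin n → Set} → (∀ x y → Dec (R x y)) → (Subset n → Carrier) → (a b c : Fin n) → Carrier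
  δ-term R? β a b c = (when (R? b c) (β (triangle a b c)) - when (R? a c) (β (triangle a b c)))
                        + when (R? a b) (β (triangle a b c))

  -- Discrete Stokes: ⟨ R , ∂ β ⟩₁ is the pairing of the coboundary of R with β.
  ⟨⟩₁-∂ : ∀ {n} {R : Fin n → Fin n → Set} (R? : ∀ x y → Dec (R x y)) (β : Subset n → Carrier) →
    (∀ {x y} → R x y → x < y) → (∀ {a b c} → a < b → b < c → δ-term R? β a b c ≈ 0#) →
    ⟨ R? , ∂ β ⟩₁ ≈ 0#
  ⟨⟩₁-∂ {n} R? β R⇒< cocycle = begin
    ⟨ R? , ∂ β ⟩₁                                      ≈⟨ sum-cong-≋ (λ x → sum-cong-≋ λ y → expand x y) ⟩
    sum₃ (λ x y v → (F₁ x y v - F₂ x y v) + F₃ x y v)  ≈⟨ sum₃-[-]+ F₁ F₂ F₃ ⟩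
    (sum₃ F₁ - sum₃ F₂) + sum₃ F₃                      ≈⟨ +-congʳ (+-cong (sum₃-rotate F₁)
                                                                          (-‿cong (sum₃-swap F₂))) ⟩
    (sum₃ G₁ - sum₃ G₂) + sum₃ F₃                      ≈⟨ sum₃-[-]+ G₁ G₂ F₃ ⟨
    sum₃ (λ a b c → (G₁ a b c - G₂ a b c) + F₃ a b c)  ≈⟨ sum-zero (λ a → sum-zero λ b →
                                                                    sum-zero λ c → vanish a b c) ⟩
    0#                                                 ∎
    where
    F₁ F₂ F₃ G₁ G₂ : Fin _ → Fin _ → Fin _ → Carrier
    F₁ x y v = when (R? x y) (when (v <? x) (β (triangle x y v)))
    F₂ x y v = when (R? x y) (when (x <? v) (when (v <? y) (β (triangle x y v))))
    F₃ x y v = when (R? x y) (when (y <? v) (β (triangle x y v)))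
    G₁ a b c = F₁ b c a
    G₂ a b c = F₂ a c b
    expand : ∀ x y → when (R? x y) (∂ β (⁅ x ⁆ ∪ ⁅ y ⁆)) ≈ sum (λ v → (F₁ x y v - F₂ x y v) + F₃ x y v)
    expand x y with R? x y
    ... | yes Rxy = trans (∂≈sum-∂-term β _) (sum-cong-≋ (∂-term-edge β (R⇒< Rxy)))
    ... | no _ = sym (sum-zero {m = n} {f = λ _ → (0# - 0#) + 0#} λ _ → [0-0]+x≈x 0#)
    vanish : ∀ a b c → (G₁ a b c - G₂ a b c) + F₃ a b c ≈ 0#
    vanish a b c with a <? b | b <? c
    ... | yes a<b | yes b<c = begin
      (G₁ a b c - G₂ a b c) + F₃ a b c
        ≈⟨ +-cong (+-cong (when-cong (R? b c) λ _ → trans (when-yes (a <? b) a<b)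
                                                          (reflexive (≡.cong β (triangle-rotate a b c))))
                          (-‿cong (when-cong (R? a c) λ _ → trans (when-yes (a <? b) a<b) (when-yes (b <? c) b<c))))
                  (when-cong (R? a b) λ _ → when-yes (b <? c) b<c) ⟩
      (when (R? b c) (β abc) - when (R? a c) (β (triangle a c b))) + when (R? a b) (β abc)
        ≈⟨ +-congʳ (+-congˡ (-‿cong (when-cong (R? a c) (λ _ → reflexive (≡.cong β (triangle-swap a b c)))))) ⟩
      (when (R? b c) (β abc) - when (R? a c) (β abc)) + when (R? a b) (β abc)
        ≈⟨ cocycle a<b b<c ⟩
      0# ∎
      where abc = triangle a b c
    ... | no a≮b | _ = trans
      (+-cong (+-cong (when-0 (R? b c) λ _ → when-no (a <? b) a≮b)
                      (-‿cong (when-0 (R? a c) λ _ → when-no (a <? b) a≮b)))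
              (when-no (R? a b) (a≮b ∘ R⇒<)))
      ([0-0]+x≈x 0#)
    ... | yes _ | no b≮c = trans
      (+-cong (+-cong (when-no (R? b c) (b≮c ∘ R⇒<))
                      (-‿cong (when-0 (R? a c) λ _ → when-0 (a <? b) λ _ → when-no (b <? c) b≮c)))
              (when-0 (R? a b) λ _ → when-no (b <? c) b≮c))
      ([0-0]+x≈x 0#)

  cocycle-detects-homology : ∀ {n} {Δ : Complex n} {k} (φ : (Subset n → Carrier) → Carrier) →
    (∀ {f g} → (∀ G → f G ≈ g G) → φ f ≈ φ g) →
    (∀ (b : Chain Δ (ℕ.suc k)) → φ (∂ (proj₁ b)) ≈ 0#) →
    (z : Chain Δ k) → (∀ G → ∂ (proj₁ z) G ≈ 0#) → φ (proj₁ z) ≈ 1# →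
    ¬ ReducedHomologyVanishes Δ k
  cocycle-detects-homology φ φ-cong φ∂≈0 z ∂z≈0 φz≈1 vanishes with vanishes z ∂z≈0
  ... | b , ∂b≈z = 1≉0 (trans (sym φz≈1) (trans (φ-cong λ G → sym (∂b≈z G)) (φ∂≈0 b)))

module DisconnectedLink {c ℓ : Level} (K : Field c ℓ) {n r : ℕ}
  (2r+2≤n : 2 ℕ.+ r ℕ.+ r ℕ.≤ n) (2≤r : 2 ℕ.≤ r) where

  open Field K hiding (zero)
  open Homology K
  open Chains K
  open TwoArcs 2r+2≤n 2≤r
  open import Relation.Binary.Reasoning.Setoid setoid

  private
    Δ = Sigma r (Cycle n)

  z : Subset n → Carrier
  z G = basis ⁅ p ⁆ G - basis ⁅ q ⁆ G

  z-chain : Chain (Link Δ F) 1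
  z-chain = z , vanish
    where
    vanish : ∀ G → ¬ (∣ G ∣ ≡ 1 × Link Δ F G) → z G ≈ 0#
    vanish G not-vertex = trans (+-cong (basis-other (not-link p∈C ⊆C⇒link))
                                        (-‿cong (basis-other (not-link q∈D ⊆D⇒link))))
                                (-‿inverseʳ 0#)
      where
      not-link : ∀ {x S} → x ∈ S → (∀ {H} → (∀ {y} → y ∈ H → y ∈ S) → Link Δ F H) → G ≢ ⁅ x ⁆
      not-link {x} x∈S link G≡x = not-vertex (≡.subst (λ H → ∣ H ∣ ≡ 1 × Link Δ F H) (≡.sym G≡x)
        (∣⁅x⁆∣≡1 x , link λ y∈x → ≡.subst (_∈ _) (≡.sym (x∈⁅y⁆⇒x≡y x y∈x)) x∈S))

  ∂z≈0 : ∀ H → ∂ z H ≈ 0#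
  ∂z≈0 H = begin
    ∂ z H                                  ≈⟨ ∂-sub (basis ⁅ p ⁆) (basis ⁅ q ⁆) H ⟩
    ∂ (basis ⁅ p ⁆) H - ∂ (basis ⁅ q ⁆) H  ≈⟨ +-cong (∂-basis-⁅⁆ p H) (-‿cong (∂-basis-⁅⁆ q H)) ⟩
    basis ⊥ H - basis ⊥ H                  ≈⟨ -‿inverseʳ _ ⟩
    0#                                     ∎

  ⟨C,z⟩≈1 : ⟨ C , z ⟩₀ ≈ 1#
  ⟨C,z⟩≈1 = begin
    ⟨ C , z ⟩₀                                             ≈⟨ sum-single p others ⟩
    when (p ∈? C) (basis ⁅ p ⁆ ⁅ p ⁆ - basis ⁅ q ⁆ ⁅ p ⁆)  ≈⟨ when-yes (p ∈? C) p∈C ⟩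
    basis ⁅ p ⁆ ⁅ p ⁆ - basis ⁅ q ⁆ ⁅ p ⁆                  ≈⟨ +-cong (basis-self ⁅ p ⁆)
                                                                      (-‿cong (basis-other (x≢y⇒⁅x⁆≢⁅y⁆ p≢q))) ⟩
    1# - 0#                                                ≈⟨ x-0≈x 1# ⟩
    1#                                                     ∎
    where
    p≢q : p ≢ q
    p≢q p≡q = q∉C (≡.subst (_∈ C) p≡q p∈C)
    others : ∀ u → u ≢ p → when (u ∈? C) (z ⁅ u ⁆) ≈ 0#
    others u u≢p with u ∈? C
    ... | no  _   = refl
    ... | yes u∈C = trans (+-cong (basis-other (x≢y⇒⁅x⁆≢⁅y⁆ u≢p)) (-‿cong (basis-other (x≢y⇒⁅x⁆≢⁅y⁆ u≢q))))
                          (-‿inverseʳ 0#)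
      where
      u≢q : u ≢ q
      u≢q u≡q = q∉C (≡.subst (_∈ C) u≡q u∈C)

  ⟨C,∂b⟩≈0 : ∀ (b : Chain (Link Δ F) 2) → ⟨ C , ∂ (proj₁ b) ⟩₀ ≈ 0#
  ⟨C,∂b⟩≈0 (β , β-support) = ⟨⟩₀-∂ C β λ u∈C v∉C → β-support _ λ (_ , link) → crossing∉link u∈C v∉C link

  ¬CohenMacaulay : ¬ CohenMacaulay (Sigma r (Cycle n))
  ¬CohenMacaulay cm = cocycle-detects-homology ⟨ C ,_⟩₀ (⟨⟩₀-cong C) ⟨C,∂b⟩≈0 z-chain ∂z≈0 ⟨C,z⟩≈1
    (cm F F-face 1 (⁅ p ⁆ ∪ ⁅ p₂ ⁆ , ⊆C⇒link edge⊆C , ∣⁅x⁆∪⁅y⁆∣ p≢p₂))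
    where
    edge⊆C : ∀ {y} → y ∈ ⁅ p ⁆ ∪ ⁅ p₂ ⁆ → y ∈ C
    edge⊆C y∈e with x∈p∪q⁻ ⁅ p ⁆ ⁅ p₂ ⁆ y∈e
    ... | inj₁ y∈p = ≡.subst (_∈ C) (≡.sym (x∈⁅y⁆⇒x≡y p y∈p)) p∈C
    ... | inj₂ y∈p₂ = ≡.subst (_∈ C) (≡.sym (x∈⁅y⁆⇒x≡y p₂ y∈p₂)) p₂∈C

module WindingCycle {c ℓ : Level} (K : Field c ℓ) {N r : ℕ}
  (r+3≤n : r ℕ.+ 3 ℕ.≤ ℕ.suc N) (n≤2r+1 : ℕ.suc N ℕ.≤ r ℕ.+ ℕ.suc r) (0<r : 0 ℕ.< r) where

  open Field K hiding (zero)
  open Homology K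
  open Chains K
  open import Algebra.Properties.Ring ring using (-0#≈0#)
  open LongEdges r+3≤n n≤2r+1 0<r
  open import Relation.Binary.Reasoning.Setoid setoid
  open import Algebra.Properties.Semiring.Sum semiring using (sum; sum-cong-≋)
  open import Data.Fin.Properties using (<⇒≢)

  private
    Δ = Sigma r (Cycle (ℕ.suc N))
    last = fromℕ N

  closingEdge : Subset (ℕ.suc N)
  closingEdge = ⁅ zero ⁆ ∪ ⁅ last ⁆

  pathEdge : Fin N → Subset (ℕ.suc N)
  pathEdge j = ⁅ inject₁ j ⁆ ∪ ⁅ suc j ⁆

  private
    0<last : toℕ (zero {N}) ℕ.< toℕ last
    0<last = Long⇒< Long-closing
    j<j+1 : ∀ (j : Fin N) → toℕ (inject₁ j) ℕ.< toℕ (suc j)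
    j<j+1 j = ℕ.s≤s (ℕₚ.≤-reflexive (toℕ-inject₁ j))

  z : Subset (ℕ.suc N) → Carrier
  z G = basis closingEdge G - sum (λ j → basis (pathEdge j) G)

  ∂z≈0 : ∀ H → ∂ z H ≈ 0#
  ∂z≈0 H = begin
    ∂ z H
      ≈⟨ ∂-sub (basis closingEdge) (λ G → sum (λ j → basis (pathEdge j) G)) H ⟩
    ∂ (basis closingEdge) H - ∂ (λ G → sum (λ j → basis (pathEdge j) G)) H
      ≈⟨ +-cong (∂-basis-edge 0<last H) (-‿cong (∂-sum (λ j → basis (pathEdge j)) H)) ⟩
    (basis ⁅ last ⁆ H - basis ⁅ zero ⁆ H) - sum (λ j → ∂ (basis (pathEdge j)) H)
      ≈⟨ +-congˡ (-‿cong (trans (sum-cong-≋ λ j → ∂-basis-edge (j<j+1 j) H)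
                                (sum-telescope (λ i → basis ⁅ i ⁆ H)))) ⟩
    (basis ⁅ last ⁆ H - basis ⁅ zero ⁆ H) - (basis ⁅ last ⁆ H - basis ⁅ zero ⁆ H)
      ≈⟨ -‿inverseʳ _ ⟩
    0# ∎

  z-chain : Chain (Link Δ ⊥) 2
  z-chain = z , vanish
    where
    vanish : ∀ G → ¬ (∣ G ∣ ≡ 2 × Link Δ ⊥ G) → z G ≈ 0#
    vanish G not-edge = trans (+-cong (basis-other (not-this closing-edge-face (<⇒≢ 0<last)))
                                      (-‿cong (sum-zero λ j →
                                        basis-other (not-this (path-edge-face j) (<⇒≢ (j<j+1 j))))))
                              (-‿inverseʳ 0#)
      where
      not-this : ∀ {x y} → Δ (⁅ x ⁆ ∪ ⁅ y ⁆) → x ≢ y → G ≢ ⁅ x ⁆ ∪ ⁅ y ⁆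
      not-this face x≢y ≡.refl = not-edge (∣⁅x⁆∪⁅y⁆∣ x≢y , Link-⊥⁺ {Δ = Δ} face)

  private
    pathEdge-short : ∀ {x y} j → Long x y → ⁅ x ⁆ ∪ ⁅ y ⁆ ≢ pathEdge j
    pathEdge-short j xy eq with ⁅⁆∪⁅⁆-injective (Long⇒< xy) (j<j+1 j) eq
    ... | ≡.refl , ≡.refl = ¬Long-successor (≡.cong ℕ.suc (≡.sym (toℕ-inject₁ j))) xy

    z-on-long : ∀ {x y} → Long x y → z (⁅ x ⁆ ∪ ⁅ y ⁆) ≈ basis closingEdge (⁅ x ⁆ ∪ ⁅ y ⁆)
    z-on-long xy = trans (+-congˡ (-‿cong (sum-zero λ j → basis-other (pathEdge-short j xy)))) (x-0≈x _)

  ⟨Long,z⟩≈1 : ⟨ Long? , z ⟩₁ ≈ 1#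
  ⟨Long,z⟩≈1 = begin
    ⟨ Long? , z ⟩₁
      ≈⟨ sum-cong-≋ (λ x → sum-cong-≋ λ y → on-long x y) ⟩
    sum (λ x → sum (λ y → when (Long? x y) (basis closingEdge (⁅ x ⁆ ∪ ⁅ y ⁆))))
      ≈⟨ sum-single zero (λ x x≢0 → sum-zero λ y → elsewhere x y (x≢0 ∘ proj₁)) ⟩
    sum (λ y → when (Long? zero y) (basis closingEdge (⁅ zero ⁆ ∪ ⁅ y ⁆)))
      ≈⟨ sum-single last (λ y y≢last → elsewhere zero y (y≢last ∘ proj₂)) ⟩
    when (Long? zero last) (basis closingEdge closingEdge)
      ≈⟨ when-yes (Long? zero last) Long-closing ⟩
    basis closingEdge closingEdge
      ≈⟨ basis-self closingEdge ⟩
    1# ∎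
    where
    on-long : ∀ x y →
      when (Long? x y) (z (⁅ x ⁆ ∪ ⁅ y ⁆)) ≈ when (Long? x y) (basis closingEdge (⁅ x ⁆ ∪ ⁅ y ⁆))
    on-long x y = when-cong (Long? x y) z-on-long
    elsewhere : ∀ x y → ¬ (x ≡ zero × y ≡ last) → when (Long? x y) (basis closingEdge (⁅ x ⁆ ∪ ⁅ y ⁆)) ≈ 0#
    elsewhere x y not-closing =
      when-0 (Long? x y) λ xy → basis-other (not-closing ∘ ⁅⁆∪⁅⁆-injective (Long⇒< xy) 0<last)

  ⟨Long,∂b⟩≈0 : ∀ (b : Chain (Link Δ ⊥) 3) → ⟨ Long? , ∂ (proj₁ b) ⟩₁ ≈ 0#
  ⟨Long,∂b⟩≈0 (β , β-support) =
    ⟨⟩₁-∂ Long? β Long⇒< λ a<b b<c → coboundary a<b b<c (Long? _ _) (Long? _ _) (Long? _ _)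
    where
    nonface⇒0 : ∀ {a b c} → ¬ Δ (triangle a b c) → β (triangle a b c) ≈ 0#
    nonface⇒0 ¬face = β-support _ λ (_ , link) → ¬face (Link-⊥⁻ {Δ = Δ} link)
    coboundary : ∀ {a b c} → toℕ a ℕ.< toℕ b → toℕ b ℕ.< toℕ c →
      (bc : Dec (Long b c)) (ac : Dec (Long a c)) (ab : Dec (Long a b)) →
      (when bc (β (triangle a b c)) - when ac (β (triangle a b c))) + when ab (β (triangle a b c)) ≈ 0#
    coboundary a<b b<c _        (no ¬ac) (yes ab) = contradiction (Long-extendʳ ab (ℕₚ.<⇒≤ b<c)) ¬ac
    coboundary a<b b<c (yes bc) (no ¬ac) _        = contradiction (Long-extendˡ (ℕₚ.<⇒≤ a<b) bc) ¬ac
    coboundary a<b b<c (no _)   (no _)   (no _)   = [0-0]+x≈x 0#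
    coboundary a<b b<c (yes bc) (yes _)  (yes ab) =
      trans (+-congʳ (-‿inverseʳ _)) (trans (+-identityˡ _) (nonface⇒0 (long-long-nonface ab bc)))
    coboundary a<b b<c (yes _)  (yes _)  (no _)   = trans (+-identityʳ _) (-‿inverseʳ _)
    coboundary a<b b<c (no _)   (yes _)  (yes _)  = trans (+-congʳ (+-identityˡ _)) (-‿inverseˡ _)
    coboundary a<b b<c (no ¬bc) (yes ac) (no ¬ab) =
      trans ([0-x]+0≈-x _) (trans (-‿cong (nonface⇒0 (short-short-long-nonface a<b b<c ¬ab ¬bc ac))) -0#≈0#)

  ¬CohenMacaulay : ¬ CohenMacaulay (Sigma r (Cycle (ℕ.suc N)))
  ¬CohenMacaulay cm = cocycle-detects-homology ⟨ Long? ,_⟩₁ (⟨⟩₁-cong Long?) ⟨Long,∂b⟩≈0 z-chain ∂z≈0 ⟨Long,z⟩≈1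
    (cm ⊥ ⊥-face 2 (triangle v₀ v₁ v₂ , Link-⊥⁺ {Δ = Δ} first-triangle-face , ∣first-triangle∣))

¬CohenMacaulay : ∀ {c ℓ} (K : Field c ℓ) {n r : ℕ} → r ℕ.+ 3 ℕ.≤ n → 2 ℕ.≤ r →
  ¬ Homology.CohenMacaulay K (Sigma r (Cycle n))
¬CohenMacaulay K {ℕ.zero}  {r} r+3≤0 _ = contradiction (ℕₚ.≤-trans (ℕₚ.m≤n+m 3 r) r+3≤0) λ ()
¬CohenMacaulay K {ℕ.suc N} {r} r+3≤n 2≤r with ℕ.suc N ℕₚ.≤? r ℕ.+ ℕ.suc r
... | yes n≤2r+1 = WindingCycle.¬CohenMacaulay K r+3≤n n≤2r+1 (ℕₚ.<-≤-trans (ℕ.s≤s ℕ.z≤n) 2≤r)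
... | no  n≰2r+1 = DisconnectedLink.¬CohenMacaulay K
  (≡.subst (ℕ._≤ ℕ.suc N) (≡.cong ℕ.suc (ℕₚ.+-suc r r)) (ℕₚ.≰⇒> n≰2r+1)) 2≤r

open import Data.Nat using (_≤_; _+_)

lemma4p9 : ∀ {c ℓ : Level} (K : Field c ℓ) (n r : ℕ) → 3 ≤ n → 2 ≤ r →
    Homology.CohenMacaulay K (Sigma r (Cycle n)) → n ≤ r + 2
lemma4p9 K n r _ 2≤r cm with n ℕₚ.≤? r + 2
... | yes n≤r+2 = n≤r+2
... | no  n≰r+2 = contradiction cm (¬CohenMacaulay K (≡.subst (_≤ n) (≡.sym (ℕₚ.+-suc r 2)) (ℕₚ.≰⇒> n≰r+2)) 2≤r)
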